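{- Unary matrix powering over $\mathbb{N}$ is $AC^0$-reducible to $\#STCON$.
   Context: Two-sorted arithmetic. A function is $\Sigma_0^B$-definable from a collection $\mathcal{L}$ if it is polynomially bounded and its (bit) graph is represented by a $\Sigma_0^B(\mathcal{L})$ formula; $F$ is $AC^0$-reducible to $\mathcal{L}$ if there are string functions $F_1,\dots,F_n$, each $\Sigma_0^B$-definable from $\mathcal{L}$ and the earlier ones, with $F$ $\Sigma_0^B$-definable from $\mathcal{L}\cup\{F_1,\dots,F_n\}$. Unary matrix powering over $\mathbb{N}$: given an $n\times n$ matrix $A$ over $\mathbb{N}$ and $k$, compute $A^k$, where the input matrix is encoded in a string $X$ with $A[i,j]=\mathrm{entry}(i,j,X)=(X^{[i]})^j$; here $X^{[i]}$ is the string with $X^{[i]}(b)\leftrightarrow b<|X|\wedge X(\langle i,b\rangle)$, $\langle x,y\rangle=(x+y)(x+y+1)+2y$, and $(Z)^j$ is the least $y<|Z|$ with $Z(\langle j,y\rangle)$, or $|Z|$ if none exists. $\#STCON(n,s,t,p,G)$ is the number (in binary) of distinct paths of length at most $p$ from $s$ to $t$ ($s\ne t$) in the directed simple graph on $n$ nodes with Boolean adjacency matrix encoded in string $G$. -}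

module Defs where

open import Data.Nat using (ℕ; zero; suc; _+_; _*_; _^_; _≤_; _≡ᵇ_; ⌊_/2⌋; _%_)
open import Data.Nat.Logarithm using (⌊log₂_⌋)
open import Data.Bool using (Bool; true; false; if_then_else_; _∧_; not)
open import Data.Fin using (Fin)
open import Data.List using (List; []; _∷_; length; map; concatMap; upTo; filterᵇ; lookup; _++_)
open import Data.Vec using (Vec; []; _∷_)
import Data.Vec as V
open import Data.Product using (Σ; _×_; _,_)
open import Data.Unit using (⊤)
open import Data.Empty using (⊥)
open import Relation.Binary.PropositionalEquality using (_≡_)

-- Strings of the standard two-sorted model.
-- A string (finite subset of ℕ) X is coded canonically by the natural
-- number Σ_{i ∈ X} 2^i.  So distinct finite sets have distinct codes.

Str : Set
Str = ℕ

bit : Str → ℕ → Bool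
bit X zero    = X % 2 ≡ᵇ 1
bit X (suc i) = bit ⌊ X /2⌋ i

-- |X| = 1 + largest element of X, or 0 if X is empty
∣_∣ₛ : Str → ℕ
∣ zero ∣ₛ  = 0
∣ suc x ∣ₛ = suc ⌊log₂ suc x ⌋

Σ< : ℕ → (ℕ → ℕ) → ℕ
Σ< zero    f = 0
Σ< (suc m) f = Σ< m f + f m

fromPred : ℕ → (ℕ → Bool) → Str
fromPred m P = Σ< m (λ b → if P b then 2 ^ b else 0)

⟨_,_⟩ : ℕ → ℕ → ℕ
⟨ x , y ⟩ = (x + y) * (x + y + 1) + 2 * y

row : Str → ℕ → Str
row X i = fromPred ∣ X ∣ₛ (λ b → bit X ⟨ i , b ⟩)

-- least y < m with P y, or m if none exists
least : ℕ → (ℕ → Bool) → ℕ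
least zero    P = 0
least (suc m) P = if P 0 then 0 else suc (least m (λ y → P (suc y)))

-- (Z)^j : least y < |Z| with Z(⟨j,y⟩), or |Z| if none
proj : Str → ℕ → ℕ
proj Z j = least ∣ Z ∣ₛ (λ y → bit Z ⟨ j , y ⟩)

entry : ℕ → ℕ → Str → ℕ
entry i j X = proj (row X i) j

Mat : Set
Mat = ℕ → ℕ → ℕ

mmul : ℕ → Mat → Mat → Mat
mmul n A B i j = Σ< n (λ l → A i l * B l j)

idMat : Mat
idMat i j = if i ≡ᵇ j then 1 else 0

mpow : ℕ → Mat → ℕ → Mat
mpow n A zero    = idMat
mpow n A (suc k) = mmul n (mpow n A k) A

matOf : Str → Mat
matOf X i j = entry i j X

-- Output encoding: the string Y with, for i,j < n,
--   Y^[⟨i,j⟩] = binary representation of (A^k)[i,j]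
-- i.e. Y(⟨⟨i,j⟩,b⟩) ↔ bit b of (A^k)[i,j] is 1, and no other elements.
encodeMat : ℕ → Mat → Str
encodeMat n M =
  Σ< n (λ i → Σ< n (λ j →
    Σ< (suc (M i j)) (λ b → if bit (M i j) b then 2 ^ ⟨ ⟨ i , j ⟩ , b ⟩ else 0)))

powNat : ℕ → ℕ → Str → Str
powNat n k X = encodeMat n (mpow n (matOf X) k)

-- edge u → v in the simple digraph with adjacency matrix G(⟨u,v⟩)
-- (the diagonal is ignored: simple graphs have no loops)
edge : Str → ℕ → ℕ → Bool
edge G u v = not (u ≡ᵇ v) ∧ bit G ⟨ u , v ⟩

seqs : ℕ → ℕ → List (List ℕ)
seqs n zero    = [] ∷ []
seqs n (suc ℓ) = concatMap (λ v → map (v ∷_) (seqs n ℓ)) (upTo n)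

walkTo : Str → ℕ → List ℕ → Bool
walkTo G t []           = false
walkTo G t (x ∷ [])     = x ≡ᵇ t
walkTo G t (x ∷ y ∷ r)  = edge G x y ∧ walkTo G t (y ∷ r)

isWalk : Str → ℕ → ℕ → List ℕ → Bool
isWalk G s t []      = false
isWalk G s t (x ∷ r) = (x ≡ᵇ s) ∧ walkTo G t (x ∷ r)

-- number of paths of length exactly ℓ (ℓ edges, ℓ+1 vertices) from s to t
pathsOfLen : ℕ → ℕ → ℕ → Str → ℕ → ℕ
pathsOfLen n s t G ℓ = length (filterᵇ (isWalk G s t) (seqs n (suc ℓ)))

-- #STCON(n,s,t,p,G): number of paths of length ≤ p, as a binary string
-- (the code of a string read as a binary number is the number itself)
#STCON : ℕ → ℕ → ℕ → ℕ → Str → Str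
#STCON n s t p G = Σ< (suc p) (pathsOfLen n s t G)

record NFun : Set where
  field
    na sa : ℕ
    fn    : Vec ℕ na → Vec Str sa → ℕ

record SFun : Set where
  field
    na sa : ℕ
    fn    : Vec ℕ na → Vec Str sa → Str

record Lang : Set where
  field
    nfs : List NFun
    sfs : List SFun

open NFun
open SFun
open Lang

L∅ : Lang
L∅ = record { nfs = [] ; sfs = [] }

addS : Lang → List SFun → Lang
addS L Fs = record { nfs = nfs L ; sfs = sfs L ++ Fs }

mutual
  data NTm (L : Lang) (nv sv : ℕ) : Set where
    nvar : Fin nv → NTm L nv sv
    zer  : NTm L nv sv
    one  : NTm L nv sv
    _⊕_  : NTm L nv sv → NTm L nv sv → NTm L nv sv
    _⊗_  : NTm L nv sv → NTm L nv sv → NTm L nv sv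
    len  : STm L nv sv → NTm L nv sv
    napp : (f : Fin (length (nfs L))) →
           Vec (NTm L nv sv) (na (lookup (nfs L) f)) →
           Vec (STm L nv sv) (NFun.sa (lookup (nfs L) f)) → NTm L nv sv

  data STm (L : Lang) (nv sv : ℕ) : Set where
    svar : Fin sv → STm L nv sv
    sapp : (F : Fin (length (sfs L))) →
           Vec (NTm L nv sv) (SFun.na (lookup (sfs L) F)) →
           Vec (STm L nv sv) (SFun.sa (lookup (sfs L) F)) → STm L nv sv

mutual
  evalN : ∀ {L nv sv} → Vec ℕ nv → Vec Str sv → NTm L nv sv → ℕ
  evalN ρ σ (nvar x)     = V.lookup ρ x
  evalN ρ σ zer          = 0
  evalN ρ σ one          = 1
  evalN ρ σ (a ⊕ b)      = evalN ρ σ a + evalN ρ σ b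
  evalN ρ σ (a ⊗ b)      = evalN ρ σ a * evalN ρ σ b
  evalN ρ σ (len X)      = ∣ evalS ρ σ X ∣ₛ
  evalN {L} ρ σ (napp f ts Ts) = NFun.fn (lookup (nfs L) f) (evalNs ρ σ ts) (evalSs ρ σ Ts)

  evalS : ∀ {L nv sv} → Vec ℕ nv → Vec Str sv → STm L nv sv → Str
  evalS ρ σ (svar X)     = V.lookup σ X
  evalS {L} ρ σ (sapp F ts Ts) = SFun.fn (lookup (sfs L) F) (evalNs ρ σ ts) (evalSs ρ σ Ts)

  evalNs : ∀ {L nv sv k} → Vec ℕ nv → Vec Str sv → Vec (NTm L nv sv) k → Vec ℕ k
  evalNs ρ σ []       = []
  evalNs ρ σ (t ∷ ts) = evalN ρ σ t ∷ evalNs ρ σ ts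

  evalSs : ∀ {L nv sv k} → Vec ℕ nv → Vec Str sv → Vec (STm L nv sv) k → Vec Str k
  evalSs ρ σ []       = []
  evalSs ρ σ (T ∷ Ts) = evalS ρ σ T ∷ evalSs ρ σ Ts

-- Σ_0^B(L) formulas: all number quantifiers bounded, no string quantifiers.
-- In ∃≤ t φ / ∀≤ t φ the bound variable is variable 0 of φ, and does not
-- occur in t.
data Fm (L : Lang) (nv sv : ℕ) : Set where
  tt ff : Fm L nv sv
  _≤ᶠ_ _=ᶠ_ : NTm L nv sv → NTm L nv sv → Fm L nv sv
  _=ˢ_ : STm L nv sv → STm L nv sv → Fm L nv sv
  mem  : NTm L nv sv → STm L nv sv → Fm L nv sv
  ¬ᶠ_  : Fm L nv sv → Fm L nv sv
  _∧ᶠ_ _∨ᶠ_ : Fm L nv sv → Fm L nv sv → Fm L nv sv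
  ∃≤ ∀≤ : NTm L nv sv → Fm L (suc nv) sv → Fm L nv sv

⟦_⟧ : ∀ {L nv sv} → Fm L nv sv → Vec ℕ nv → Vec Str sv → Set
⟦ tt ⟧ ρ σ      = ⊤
⟦ ff ⟧ ρ σ      = ⊥
⟦ a ≤ᶠ b ⟧ ρ σ  = evalN ρ σ a ≤ evalN ρ σ b
⟦ a =ᶠ b ⟧ ρ σ  = evalN ρ σ a ≡ evalN ρ σ b
⟦ A =ˢ B ⟧ ρ σ  = evalS ρ σ A ≡ evalS ρ σ B
⟦ mem t X ⟧ ρ σ = bit (evalS ρ σ X) (evalN ρ σ t) ≡ true
⟦ ¬ᶠ φ ⟧ ρ σ    = ⟦ φ ⟧ ρ σ → ⊥
⟦ φ ∧ᶠ ψ ⟧ ρ σ  = ⟦ φ ⟧ ρ σ × ⟦ ψ ⟧ ρ σ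
⟦ φ ∨ᶠ ψ ⟧ ρ σ  = Σ Bool (λ { true → ⟦ φ ⟧ ρ σ ; false → ⟦ ψ ⟧ ρ σ })
⟦ ∃≤ t φ ⟧ ρ σ  = Σ ℕ (λ x → x ≤ evalN ρ σ t × ⟦ φ ⟧ (x ∷ ρ) σ)
⟦ ∀≤ t φ ⟧ ρ σ  = (x : ℕ) → x ≤ evalN ρ σ t → ⟦ φ ⟧ (x ∷ ρ) σ

Σ0B-Definable : Lang → SFun → Set
Σ0B-Definable L F =
  Σ (NTm L∅ (SFun.na F) (SFun.sa F)) λ t →
  Σ (Fm L (suc (SFun.na F)) (SFun.sa F)) λ φ →
    (xs : Vec ℕ (SFun.na F)) (Xs : Vec Str (SFun.sa F)) →
      (∣ SFun.fn F xs Xs ∣ₛ ≤ evalN xs Xs t) ×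
      ((i : ℕ) → (bit (SFun.fn F xs Xs) i ≡ true → ⟦ φ ⟧ (i ∷ xs) Xs)
               × (⟦ φ ⟧ (i ∷ xs) Xs → bit (SFun.fn F xs Xs) i ≡ true))

DefChain : Lang → List SFun → Set
DefChain L []       = ⊤
DefChain L (F ∷ Fs) = Σ0B-Definable L F × DefChain (addS L (F ∷ [])) Fs

AC0-Reducible : SFun → Lang → Set
AC0-Reducible F L =
  Σ (List SFun) λ Fs → DefChain L Fs × Σ0B-Definable (addS L Fs) F

PowNatF : SFun
PowNatF = record { na = 2 ; sa = 1 ; fn = λ { (n ∷ k ∷ []) (X ∷ []) → powNat n k X } }

#STCONF : SFun
#STCONF = record { na = 4 ; sa = 1 ; fn = λ { (n ∷ s ∷ t ∷ p ∷ []) (G ∷ []) → #STCON n s t p G } }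

#STCON-Lang : Lang
#STCON-Lang = record { nfs = [] ; sfs = #STCONF ∷ [] }

module Submission where

-- Following the paper, the entries of A^k are path counts.  From the input
-- (n, k, X) we define, by a Σ_0^B formula, a layered digraph G(n,k,X): one
-- layer of n "main" vertices for each r ≤ k, and between consecutive layers
-- a "gadget" vertex for every c < A[i,j], so that main(r+1,i) reaches
-- main(r,j) by exactly A[i,j] two-edge paths.  Hence the paths from
-- main(k,i) to main(0,j) all have length 2k and there are (A^k)[i,j] of
-- them, and the bits of PowNat(n,k,X) are bits of #STCON values on G.

open import Defs
open import Data.Nat using (ℕ; zero; suc; s≤s⁻¹; _+_; _*_; _∸_; _^_; _≤_; _<_; z≤n; s≤s; _≡ᵇ_; _<ᵇ_; _≤ᵇ_; _≤?_; ⌊_/2⌋; ⌈_/2⌉; _%_)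
open import Data.Nat.Properties
open import Data.Nat.Logarithm using (⌊log₂_⌋; ⌊log₂⌋-mono-≤; ⌊log₂⌊n/2⌋⌋≡⌊log₂n⌋∸1; ⌊log₂[2^n]⌋≡n)
open import Data.Nat.DivMod using ([m+n]%n≡m%n)
open import Data.Nat.ListAction using (sum)
open import Data.Nat.Tactic.RingSolver using (solve-∀)
open import Data.Bool using (Bool; true; false; if_then_else_; _∧_; _∨_; not)
open import Data.Bool.Properties using (T-≡)
open import Data.Fin using (#_)
open import Data.List using (List; []; _∷_; length; map; concatMap; upTo; applyUpTo; filterᵇ; _++_)
open import Data.List.Properties using (map-applyUpTo; map-cong)
open import Data.Vec using (Vec; []; _∷_)
open import Data.Product using (Σ; _×_; _,_; proj₁; proj₂)
open import Data.Sum using (_⊎_; inj₁; inj₂)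
open import Data.Unit using (tt)
open import Data.Empty using (⊥; ⊥-elim)
open import Function.Bundles using (_⇔_; mk⇔; Equivalence)
open import Algebra.Properties.CommutativeSemigroup +-commutativeSemigroup using (interchange)
open import Relation.Binary using (tri<; tri≈; tri>)
open import Relation.Binary.PropositionalEquality
open import Relation.Nullary using (yes; no)

open Equivalence using (to; from)

true≢false : true ≡ false → ⊥
true≢false ()

bool-cases : ∀ (b : Bool) → (b ≡ true) ⊎ (b ≡ false)
bool-cases true  = inj₁ refl
bool-cases false = inj₂ refl

∨-true : ∀ a b → (a ∨ b) ≡ true → (a ≡ true) ⊎ (b ≡ true)
∨-true true  b p = inj₁ refl
∨-true false b p = inj₂ p

∨-introˡ : ∀ {a} b → a ≡ true → (a ∨ b) ≡ true
∨-introˡ b refl = refl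

∨-introʳ : ∀ a {b} → b ≡ true → (a ∨ b) ≡ true
∨-introʳ true  p = refl
∨-introʳ false p = p

∧-true : ∀ a b → (a ∧ b) ≡ true → a ≡ true × b ≡ true
∧-true true true p = refl , refl

∧-intro : ∀ {a b} → a ≡ true → b ≡ true → (a ∧ b) ≡ true
∧-intro refl refl = refl

not-true : ∀ {b} → not b ≡ true → b ≡ true → ⊥
not-true {true} () q

not-intro : ∀ b → (b ≡ true → ⊥) → not b ≡ true
not-intro true  h = ⊥-elim (h refl)
not-intro false h = refl

≡ᵇ-true : ∀ m n → (m ≡ᵇ n) ≡ true → m ≡ n
≡ᵇ-true m n p = ≡ᵇ⇒≡ m n (from T-≡ p)

≡ᵇ-refl : ∀ m → (m ≡ᵇ m) ≡ true
≡ᵇ-refl m = to T-≡ (≡⇒≡ᵇ m m refl)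

≡ᵇ-false : ∀ m n → (m ≡ n → ⊥) → (m ≡ᵇ n) ≡ false
≡ᵇ-false m n m≢n with bool-cases (m ≡ᵇ n)
... | inj₁ p = ⊥-elim (m≢n (≡ᵇ-true m n p))
... | inj₂ p = p

data Parity : ℕ → Set where
  even : ∀ h → Parity (h + h)
  odd  : ∀ h → Parity (suc (h + h))

parity : ∀ n → Parity n
parity zero = even 0
parity (suc n) with parity n
... | even h = odd h
... | odd h  = subst Parity (cong suc (+-suc h h)) (even (suc h))

bit-0 : ∀ z → bit 0 z ≡ false
bit-0 zero    = refl
bit-0 (suc z) = bit-0 z

bit-ss-low : ∀ x → bit (suc (suc x)) 0 ≡ bit x 0
bit-ss-low x = cong (_≡ᵇ 1) (trans (cong (_% 2) (+-comm 2 x)) ([m+n]%n≡m%n x 2))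

bit-even-low : ∀ h → bit (h + h) 0 ≡ false
bit-even-low zero    = refl
bit-even-low (suc h) rewrite +-suc h h = trans (bit-ss-low (h + h)) (bit-even-low h)

bit-odd-low : ∀ h → bit (suc (h + h)) 0 ≡ true
bit-odd-low zero    = refl
bit-odd-low (suc h) rewrite +-suc h h = trans (bit-ss-low (suc (h + h))) (bit-odd-low h)

half-odd : ∀ h → ⌊ suc (h + h) /2⌋ ≡ h
half-odd zero    = refl
half-odd (suc h) rewrite +-suc h h = cong suc (half-odd h)

bit-even-high : ∀ h z → bit (h + h) (suc z) ≡ bit h z
bit-even-high h z = cong (λ w → bit w z) (sym (n≡⌊n+n/2⌋ h))

bit-odd-high : ∀ h z → bit (suc (h + h)) (suc z) ≡ bit h z
bit-odd-high h z = cong (λ w → bit w z) (half-odd h)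

bit-pow : ∀ e z → bit (2 ^ e) z ≡ (e ≡ᵇ z)
bit-pow zero zero    = refl
bit-pow zero (suc z) = bit-0 z
bit-pow (suc e) z rewrite +-identityʳ (2 ^ e) with z
... | zero  = bit-even-low (2 ^ e)
... | suc y = trans (bit-even-high (2 ^ e) y) (bit-pow e y)

-- Numbers with disjoint bit sets add without carries: their sum is the union.
Disjoint : ℕ → ℕ → Set
Disjoint a b = ∀ z → bit a z ≡ true → bit b z ≡ true → ⊥

bit-+ : ∀ z a b → Disjoint a b → bit (a + b) z ≡ (bit a z ∨ bit b z)
bit-+ z a b d with parity a | parity b
bit-+ zero .(h + h) .(h' + h') d | even h | even h'
  rewrite interchange h h h' h' =
  trans (bit-even-low (h + h')) (sym (cong₂ _∨_ (bit-even-low h) (bit-even-low h')))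
bit-+ (suc z) .(h + h) .(h' + h') d | even h | even h'
  rewrite interchange h h h' h' | bit-even-high (h + h') z | bit-even-high h z | bit-even-high h' z =
  bit-+ z h h' (λ y p q → d (suc y) (trans (bit-even-high h y) p) (trans (bit-even-high h' y) q))
bit-+ z .(h + h) .(suc (h' + h')) d | even h | odd h'
  rewrite +-suc (h + h) (h' + h') | interchange h h h' h' with z
... | zero  = trans (bit-odd-low (h + h')) (sym (cong₂ _∨_ (bit-even-low h) (bit-odd-low h')))
... | suc y rewrite bit-odd-high (h + h') y | bit-even-high h y | bit-odd-high h' y =
  bit-+ y h h' (λ w p q → d (suc w) (trans (bit-even-high h w) p) (trans (bit-odd-high h' w) q))
bit-+ z .(suc (h + h)) .(h' + h') d | odd h | even h'
  rewrite interchange h h h' h' with z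
... | zero  = trans (bit-odd-low (h + h')) (sym (cong₂ _∨_ (bit-odd-low h) (bit-even-low h')))
... | suc y rewrite bit-odd-high (h + h') y | bit-odd-high h y | bit-even-high h' y =
  bit-+ y h h' (λ w p q → d (suc w) (trans (bit-odd-high h w) p) (trans (bit-even-high h' w) q))
bit-+ z .(suc (h + h)) .(suc (h' + h')) d | odd h | odd h' =
  ⊥-elim (d 0 (bit-odd-low h) (bit-odd-low h'))

sum-bits : (m : ℕ) (f : ℕ → ℕ) (S : ℕ → ℕ → Set) →
  (∀ x z → bit (f x) z ≡ true ⇔ S x z) →
  (∀ x y z → S x z → S y z → x ≡ y) →
  ∀ z → bit (Σ< m f) z ≡ true ⇔ (Σ ℕ λ x → x < m × S x z)
sum-bits zero f S bits-f unique z =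
  mk⇔ (λ p → ⊥-elim (true≢false (trans (sym p) (bit-0 z)))) (λ { (x , () , _) })
sum-bits (suc m) f S bits-f unique z = mk⇔ into back
  where
  IH : ∀ z → bit (Σ< m f) z ≡ true ⇔ (Σ ℕ λ x → x < m × S x z)
  IH = sum-bits m f S bits-f unique
  disjoint : Disjoint (Σ< m f) (f m)
  disjoint y p q with to (IH y) p
  ... | (x , x<m , s) = <-irrefl (unique x m y s (to (bits-f m y) q)) x<m
  split : bit (Σ< (suc m) f) z ≡ (bit (Σ< m f) z ∨ bit (f m) z)
  split = bit-+ z (Σ< m f) (f m) disjoint
  into : bit (Σ< (suc m) f) z ≡ true → Σ ℕ λ x → x < suc m × S x z
  into p with ∨-true _ _ (trans (sym split) p)
  ... | inj₁ q = let (x , x<m , s) = to (IH z) q in x , m<n⇒m<1+n x<m , s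
  ... | inj₂ q = m , ≤-refl , to (bits-f m z) q
  back : (Σ ℕ λ x → x < suc m × S x z) → bit (Σ< (suc m) f) z ≡ true
  back (x , x<1+m , s) with m≤n⇒m<n∨m≡n (s≤s⁻¹ x<1+m)
  ... | inj₁ x<m  = trans split (∨-introˡ _ (from (IH z) (x , x<m , s)))
  ... | inj₂ refl = trans split (∨-introʳ _ (from (bits-f m z) s))

bit-if-pow : ∀ (c : Bool) e z → bit (if c then 2 ^ e else 0) z ≡ true ⇔ (c ≡ true × e ≡ z)
bit-if-pow true  e z = mk⇔ (λ p → refl , ≡ᵇ-true e z (trans (sym (bit-pow e z)) p))
                           (λ { (_ , refl) → trans (bit-pow e e) (≡ᵇ-refl e) })
bit-if-pow false e z = mk⇔ (λ p → ⊥-elim (true≢false (trans (sym p) (bit-0 z)))) (λ ())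

bit-fromPred : ∀ m P z → bit (fromPred m P) z ≡ true ⇔ (z < m × P z ≡ true)
bit-fromPred m P z = mk⇔
  (λ p → let (x , x<m , Px , x≡z) = to (bits z) p in subst (_< m) x≡z x<m , subst (λ w → P w ≡ true) x≡z Px)
  (λ { (z<m , Pz) → from (bits z) (z , z<m , Pz , refl) })
  where
  bits : ∀ z → bit (fromPred m P) z ≡ true ⇔ (Σ ℕ λ x → x < m × (P x ≡ true × x ≡ z))
  bits = sum-bits m (λ b → if P b then 2 ^ b else 0) (λ x z → P x ≡ true × x ≡ z)
           (λ x z → bit-if-pow (P x) x z) (λ { x y z (_ , p) (_ , q) → trans p (sym q) })

len-suc : ∀ x → ∣ suc x ∣ₛ ≡ suc ∣ ⌊ suc x /2⌋ ∣ₛ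
len-suc zero    = cong suc (⌊log₂[2^n]⌋≡n 0)
len-suc (suc y) = cong suc (sym (begin
  suc ⌊log₂ ⌊ suc (suc y) /2⌋ ⌋          ≡⟨ cong suc (⌊log₂⌊n/2⌋⌋≡⌊log₂n⌋∸1 (suc (suc y))) ⟩
  suc (⌊log₂ suc (suc y) ⌋ ∸ 1)          ≡⟨ +-comm 1 _ ⟩
  (⌊log₂ suc (suc y) ⌋ ∸ 1) + 1          ≡⟨ m∸n+n≡m 1≤log ⟩
  ⌊log₂ suc (suc y) ⌋                    ∎))
  where
  open ≡-Reasoning
  1≤log : 1 ≤ ⌊log₂ suc (suc y) ⌋
  1≤log = subst (_≤ ⌊log₂ suc (suc y) ⌋) (⌊log₂[2^n]⌋≡n 1) (⌊log₂⌋-mono-≤ {2} {suc (suc y)} (s≤s (s≤s z≤n)))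

bit<len : ∀ b Z → bit Z b ≡ true → b < ∣ Z ∣ₛ
bit<len zero    zero    p = ⊥-elim (true≢false (sym p))
bit<len zero    (suc x) p = s≤s z≤n
bit<len (suc b) zero    p = ⊥-elim (true≢false (trans (sym p) (bit-0 b)))
bit<len (suc b) (suc x) p = subst (suc b <_) (sym (len-suc x)) (s≤s (bit<len b ⌊ suc x /2⌋ p))

top-bit : ∀ x → bit (suc x) ⌊log₂ suc x ⌋ ≡ true
top-bit x = go (suc x) x ≤-refl
  where
  -- well-founded recursion on x, with an explicit fuel bound
  go : ∀ fuel x → x < fuel → bit (suc x) ⌊log₂ suc x ⌋ ≡ true
  go (suc fuel) zero    lt = refl
  go (suc fuel) (suc y) lt =
    subst (λ w → bit (suc (suc y)) w ≡ true) (suc-injective (sym (len-suc (suc y))))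
      (go fuel ⌊ y /2⌋ (≤-trans (s≤s (⌊n/2⌋≤n y)) (s≤s⁻¹ lt)))

len-bound : ∀ Z m → (∀ b → bit Z b ≡ true → b < m) → ∣ Z ∣ₛ ≤ m
len-bound zero    m h = z≤n
len-bound (suc x) m h = h _ (top-bit x)

len-above : ∀ Z c → c < ∣ Z ∣ₛ ⇔ (Σ ℕ λ b → c ≤ b × bit Z b ≡ true)
len-above Z c = mk⇔ (witness Z) (λ { (b , c≤b , Zb) → ≤-<-trans c≤b (bit<len b Z Zb) })
  where
  witness : ∀ Z → c < ∣ Z ∣ₛ → Σ ℕ λ b → c ≤ b × bit Z b ≡ true
  witness (suc x) lt = ⌊log₂ suc x ⌋ , s≤s⁻¹ lt , top-bit x

len-fromPred : ∀ m P → ∣ fromPred m P ∣ₛ ≤ m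
len-fromPred m P = len-bound _ m (λ b p → proj₁ (to (bit-fromPred m P b) p))

pow≤bit : ∀ b Z → bit Z b ≡ true → 2 ^ b ≤ Z
pow≤bit zero    zero    p = ⊥-elim (true≢false (sym p))
pow≤bit zero    (suc x) p = s≤s z≤n
pow≤bit (suc b) Z p = begin
  2 ^ b + (2 ^ b + 0)   ≡⟨ cong (2 ^ b +_) (+-identityʳ (2 ^ b)) ⟩
  2 ^ b + 2 ^ b         ≤⟨ +-mono-≤ ih ih ⟩
  ⌊ Z /2⌋ + ⌊ Z /2⌋     ≤⟨ +-monoʳ-≤ ⌊ Z /2⌋ (⌊n/2⌋≤⌈n/2⌉ Z) ⟩
  ⌊ Z /2⌋ + ⌈ Z /2⌉     ≡⟨ ⌊n/2⌋+⌈n/2⌉≡n Z ⟩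
  Z                     ∎
  where
  open ≤-Reasoning
  ih : 2 ^ b ≤ ⌊ Z /2⌋
  ih = pow≤bit b ⌊ Z /2⌋ p

-- Σ_0^B formulas are decidable: bounded quantifiers become finite
-- disjunctions and conjunctions.  'evalB' is the Boolean truth value and
-- 'evalB-correct' says it agrees with the semantics ⟦_⟧.

anyB : ℕ → (ℕ → Bool) → Bool
anyB zero    P = false
anyB (suc m) P = anyB m P ∨ P m

allB : ℕ → (ℕ → Bool) → Bool
allB zero    P = true
allB (suc m) P = allB m P ∧ P m

anyB-correct : ∀ m P → anyB m P ≡ true ⇔ (Σ ℕ λ x → x < m × P x ≡ true)
anyB-correct zero    P = mk⇔ (λ ()) (λ { (x , () , _) })
anyB-correct (suc m) P = mk⇔ into back
  where
  into : anyB (suc m) P ≡ true → Σ ℕ λ x → x < suc m × P x ≡ true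
  into p with ∨-true (anyB m P) (P m) p
  ... | inj₁ q = let (x , x<m , Px) = to (anyB-correct m P) q in x , m<n⇒m<1+n x<m , Px
  ... | inj₂ q = m , ≤-refl , q
  back : (Σ ℕ λ x → x < suc m × P x ≡ true) → anyB (suc m) P ≡ true
  back (x , x<1+m , Px) with m≤n⇒m<n∨m≡n (s≤s⁻¹ x<1+m)
  ... | inj₁ x<m  = ∨-introˡ _ (from (anyB-correct m P) (x , x<m , Px))
  ... | inj₂ refl = ∨-introʳ _ Px

allB-correct : ∀ m P → allB m P ≡ true ⇔ (∀ x → x < m → P x ≡ true)
allB-correct zero    P = mk⇔ (λ _ x ()) (λ _ → refl)
allB-correct (suc m) P = mk⇔ into back
  where
  into : allB (suc m) P ≡ true → ∀ x → x < suc m → P x ≡ true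
  into p x x<1+m with ∧-true (allB m P) (P m) p | m≤n⇒m<n∨m≡n (s≤s⁻¹ x<1+m)
  ... | (q , r) | inj₁ x<m  = to (allB-correct m P) q x x<m
  ... | (q , r) | inj₂ refl = r
  back : (∀ x → x < suc m → P x ≡ true) → allB (suc m) P ≡ true
  back h = ∧-intro (from (allB-correct m P) (λ x x<m → h x (m<n⇒m<1+n x<m))) (h m ≤-refl)

evalB : ∀ {L nv sv} → Fm L nv sv → Vec ℕ nv → Vec Str sv → Bool
evalB tt        ρ σ = true
evalB ff        ρ σ = false
evalB (a ≤ᶠ b)  ρ σ = evalN ρ σ a ≤ᵇ evalN ρ σ b
evalB (a =ᶠ b)  ρ σ = evalN ρ σ a ≡ᵇ evalN ρ σ b
evalB (A =ˢ B)  ρ σ = evalS ρ σ A ≡ᵇ evalS ρ σ B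
evalB (mem t X) ρ σ = bit (evalS ρ σ X) (evalN ρ σ t)
evalB (¬ᶠ φ)    ρ σ = not (evalB φ ρ σ)
evalB (φ ∧ᶠ ψ)  ρ σ = evalB φ ρ σ ∧ evalB ψ ρ σ
evalB (φ ∨ᶠ ψ)  ρ σ = evalB φ ρ σ ∨ evalB ψ ρ σ
evalB (∃≤ t φ)  ρ σ = anyB (suc (evalN ρ σ t)) (λ x → evalB φ (x ∷ ρ) σ)
evalB (∀≤ t φ)  ρ σ = allB (suc (evalN ρ σ t)) (λ x → evalB φ (x ∷ ρ) σ)

≡ᵇ-correct : ∀ m n → m ≡ n ⇔ (m ≡ᵇ n) ≡ true
≡ᵇ-correct m n = mk⇔ (λ { refl → ≡ᵇ-refl m }) (≡ᵇ-true m n)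

evalB-correct : ∀ {L nv sv} (φ : Fm L nv sv) ρ σ → ⟦ φ ⟧ ρ σ ⇔ evalB φ ρ σ ≡ true
evalB-correct tt        ρ σ = mk⇔ (λ _ → refl) (λ _ → tt)
evalB-correct ff        ρ σ = mk⇔ (λ ()) (λ ())
evalB-correct (a ≤ᶠ b)  ρ σ = mk⇔ (λ p → to T-≡ (≤⇒≤ᵇ p)) (λ p → ≤ᵇ⇒≤ _ _ (from T-≡ p))
evalB-correct (a =ᶠ b)  ρ σ = ≡ᵇ-correct _ _
evalB-correct (A =ˢ B)  ρ σ = ≡ᵇ-correct _ _
evalB-correct (mem t X) ρ σ = mk⇔ (λ p → p) (λ p → p)
evalB-correct (¬ᶠ φ)    ρ σ = mk⇔ (λ h → not-intro _ (λ q → h (from IH q))) (λ p q → not-true p (to IH q))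
  where
  IH : ⟦ φ ⟧ ρ σ ⇔ evalB φ ρ σ ≡ true
  IH = evalB-correct φ ρ σ
evalB-correct (φ ∧ᶠ ψ)  ρ σ =
  mk⇔ (λ { (p , q) → ∧-intro (to IHφ p) (to IHψ q) })
      (λ p → let (a , b) = ∧-true _ _ p in from IHφ a , from IHψ b)
  where
  IHφ : ⟦ φ ⟧ ρ σ ⇔ evalB φ ρ σ ≡ true
  IHφ = evalB-correct φ ρ σ
  IHψ : ⟦ ψ ⟧ ρ σ ⇔ evalB ψ ρ σ ≡ true
  IHψ = evalB-correct ψ ρ σ
evalB-correct (φ ∨ᶠ ψ)  ρ σ = mk⇔ into back
  where
  IHφ : ⟦ φ ⟧ ρ σ ⇔ evalB φ ρ σ ≡ true
  IHφ = evalB-correct φ ρ σ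
  IHψ : ⟦ ψ ⟧ ρ σ ⇔ evalB ψ ρ σ ≡ true
  IHψ = evalB-correct ψ ρ σ
  into : ⟦ φ ∨ᶠ ψ ⟧ ρ σ → (evalB φ ρ σ ∨ evalB ψ ρ σ) ≡ true
  into (true  , p) = ∨-introˡ _ (to IHφ p)
  into (false , p) = ∨-introʳ _ (to IHψ p)
  back : (evalB φ ρ σ ∨ evalB ψ ρ σ) ≡ true → ⟦ φ ∨ᶠ ψ ⟧ ρ σ
  back p with ∨-true _ _ p
  ... | inj₁ q = true  , from IHφ q
  ... | inj₂ q = false , from IHψ q
evalB-correct (∃≤ t φ)  ρ σ = mk⇔
  (λ { (x , x≤t , p) → from (anyB-correct _ _) (x , s≤s x≤t , to (IH x) p) })
  (λ p → let (x , x<t , q) = to (anyB-correct _ _) p in x , s≤s⁻¹ x<t , from (IH x) q)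
  where
  IH : ∀ x → ⟦ φ ⟧ (x ∷ ρ) σ ⇔ evalB φ (x ∷ ρ) σ ≡ true
  IH x = evalB-correct φ (x ∷ ρ) σ
evalB-correct (∀≤ t φ)  ρ σ = mk⇔
  (λ h → from (allB-correct _ _) (λ x x<t → to (IH x) (h x (s≤s⁻¹ x<t))))
  (λ p x x≤t → from (IH x) (to (allB-correct _ _) p x (s≤s x≤t)))
  where
  IH : ∀ x → ⟦ φ ⟧ (x ∷ ρ) σ ⇔ evalB φ (x ∷ ρ) σ ≡ true
  IH x = evalB-correct φ (x ∷ ρ) σ

-- The string is opaque, so that it is only
-- ever inspected through 'bit-formulaString' (and type checking compares
-- such strings by their parameters rather than by unfolding φ).
opaque
  formulaString : ∀ {L na sa} → NTm L∅ na sa → Fm L (suc na) sa → Vec ℕ na → Vec Str sa → Str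
  formulaString t φ xs Xs = fromPred (evalN xs Xs t) (λ i → evalB φ (i ∷ xs) Xs)

  bit-formulaString : ∀ {L na sa} (t : NTm L∅ na sa) (φ : Fm L (suc na) sa) xs Xs i →
    bit (formulaString t φ xs Xs) i ≡ true ⇔ (i < evalN xs Xs t × ⟦ φ ⟧ (i ∷ xs) Xs)
  bit-formulaString t φ xs Xs i = mk⇔
    (λ p → let (i<t , φi) = to bits p in i<t , from (evalB-correct φ (i ∷ xs) Xs) φi)
    (λ { (i<t , φi) → from bits (i<t , to (evalB-correct φ (i ∷ xs) Xs) φi) })
    where
    bits : bit (formulaString t φ xs Xs) i ≡ true ⇔ (i < evalN xs Xs t × evalB φ (i ∷ xs) Xs ≡ true)
    bits = bit-fromPred (evalN xs Xs t) (λ j → evalB φ (j ∷ xs) Xs) i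

  len-formulaString : ∀ {L na sa} (t : NTm L∅ na sa) (φ : Fm L (suc na) sa) xs Xs →
    ∣ formulaString t φ xs Xs ∣ₛ ≤ evalN xs Xs t
  len-formulaString t φ xs Xs = len-fromPred _ _

formulaFn : ∀ {L} na sa → NTm L∅ na sa → Fm L (suc na) sa → SFun
formulaFn na sa t φ = record { na = na ; sa = sa ; fn = formulaString t φ }

formulaFn-definable : ∀ {L na sa} (t : NTm L∅ na sa) (φ : Fm L (suc na) sa) →
  (∀ xs Xs i → ⟦ φ ⟧ (i ∷ xs) Xs → i < evalN xs Xs t) →
  Σ0B-Definable L (formulaFn na sa t φ)
formulaFn-definable t φ bounded = t , φ , λ xs Xs →
  len-formulaString t φ xs Xs ,
  λ i → (λ p → proj₂ (to (bit-formulaString t φ xs Xs i) p)) ,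
        (λ s → from (bit-formulaString t φ xs Xs i) (bounded xs Xs i s , s))

Σ-cong : ∀ m {f g : ℕ → ℕ} → (∀ x → x < m → f x ≡ g x) → Σ< m f ≡ Σ< m g
Σ-cong zero    h = refl
Σ-cong (suc m) h = cong₂ _+_ (Σ-cong m (λ x x<m → h x (m<n⇒m<1+n x<m))) (h m ≤-refl)

Σ-zero : ∀ m {f : ℕ → ℕ} → (∀ x → x < m → f x ≡ 0) → Σ< m f ≡ 0
Σ-zero m h = trans (Σ-cong m h) (Σ-const0 m)
  where
  Σ-const0 : ∀ m → Σ< m (λ _ → 0) ≡ 0
  Σ-const0 zero    = refl
  Σ-const0 (suc m) = cong (_+ 0) (Σ-const0 m)

Σ-const : ∀ m h → Σ< m (λ _ → h) ≡ m * h
Σ-const zero    h = refl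
Σ-const (suc m) h = trans (cong (_+ h) (Σ-const m h)) (+-comm (m * h) h)

Σ-shift : ∀ m (f : ℕ → ℕ) → Σ< (suc m) f ≡ f 0 + Σ< m (λ x → f (suc x))
Σ-shift zero    f = +-comm 0 (f 0)
Σ-shift (suc m) f = trans (cong (_+ f (suc m)) (Σ-shift m f)) (+-assoc (f 0) _ _)

Σ-+ : ∀ m (f g : ℕ → ℕ) → Σ< m (λ x → f x + g x) ≡ Σ< m f + Σ< m g
Σ-+ zero    f g = refl
Σ-+ (suc m) f g = trans (cong (_+ (f m + g m)) (Σ-+ m f g)) (interchange (Σ< m f) (Σ< m g) (f m) (g m))

Σ-*ˡ : ∀ m a (f : ℕ → ℕ) → Σ< m (λ x → a * f x) ≡ a * Σ< m f
Σ-*ˡ zero    a f = sym (*-zeroʳ a)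
Σ-*ˡ (suc m) a f = trans (cong (_+ a * f m) (Σ-*ˡ m a f)) (sym (*-distribˡ-+ a (Σ< m f) (f m)))

Σ-*ʳ : ∀ m a (f : ℕ → ℕ) → Σ< m (λ x → f x * a) ≡ Σ< m f * a
Σ-*ʳ zero    a f = refl
Σ-*ʳ (suc m) a f = trans (cong (_+ f m * a) (Σ-*ʳ m a f)) (sym (*-distribʳ-+ a (Σ< m f) (f m)))

Σ-swap : ∀ m k (f : ℕ → ℕ → ℕ) → Σ< m (λ x → Σ< k (f x)) ≡ Σ< k (λ y → Σ< m (λ x → f x y))
Σ-swap zero    k f = sym (Σ-zero k (λ _ _ → refl))
Σ-swap (suc m) k f = trans (cong (_+ Σ< k (f m)) (Σ-swap m k f)) (sym (Σ-+ k (λ y → Σ< m (λ x → f x y)) (f m)))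

Σ-append : ∀ m k (f : ℕ → ℕ) → Σ< (m + k) f ≡ Σ< m f + Σ< k (λ y → f (m + y))
Σ-append m zero    f rewrite +-identityʳ m = sym (+-identityʳ _)
Σ-append m (suc k) f rewrite +-suc m k | Σ-append m k f = +-assoc (Σ< m f) _ _

Σ-blocks : ∀ a C (f : ℕ → ℕ) → Σ< (a * C) f ≡ Σ< a (λ x → Σ< C (λ q → f (x * C + q)))
Σ-blocks zero    C f = refl
Σ-blocks (suc a) C f = trans (cong (λ w → Σ< w f) (+-comm C (a * C)))
  (trans (Σ-append (a * C) C f) (cong (_+ Σ< C (λ y → f (a * C + y))) (Σ-blocks a C f)))

Σ-bound : ∀ m B (f : ℕ → ℕ) → (∀ x → x < m → f x ≤ B) → Σ< m f ≤ m * B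
Σ-bound zero    B f h = z≤n
Σ-bound (suc m) B f h = subst (Σ< (suc m) f ≤_) (+-comm (m * B) B)
  (+-mono-≤ (Σ-bound m B f (λ x x<m → h x (m<n⇒m<1+n x<m))) (h m ≤-refl))

<ᵇ-true : ∀ m n → m < n → (m <ᵇ n) ≡ true
<ᵇ-true m n p = to T-≡ (<⇒<ᵇ p)

<ᵇ-false : ∀ m n → n ≤ m → (m <ᵇ n) ≡ false
<ᵇ-false m n n≤m with bool-cases (m <ᵇ n)
... | inj₁ p = ⊥-elim (<⇒≱ (<ᵇ⇒< m n (from T-≡ p)) n≤m)
... | inj₂ p = p

Σ-threshold : ∀ W a h → a ≤ W → Σ< W (λ c → if c <ᵇ a then h else 0) ≡ a * h
Σ-threshold zero .zero h z≤n = refl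
Σ-threshold (suc W) a h a≤1+W with m≤n⇒m<n∨m≡n a≤1+W
... | inj₁ a<1+W rewrite Σ-threshold W a h (s≤s⁻¹ a<1+W) | <ᵇ-false W a (s≤s⁻¹ a<1+W) = +-identityʳ (a * h)
... | inj₂ refl rewrite <ᵇ-true W (suc W) ≤-refl = trans (cong (_+ h) below) (+-comm (W * h) h)
  where
  below : Σ< W (λ c → if c <ᵇ suc W then h else 0) ≡ W * h
  below = trans (Σ-cong W (λ c c<W → cong (λ b → if b then h else 0) (<ᵇ-true c (suc W) (m<n⇒m<1+n c<W))))
                (Σ-const W h)

Σ-single : ∀ N s (f : ℕ → ℕ) → s < N → (∀ w → w < N → (w ≡ s → ⊥) → f w ≡ 0) → Σ< N f ≡ f s
Σ-single (suc N) s f s<1+N off with m≤n⇒m<n∨m≡n (s≤s⁻¹ s<1+N)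
... | inj₁ s<N = trans (cong₂ _+_ (Σ-single N s f s<N (λ w w<N → off w (m<n⇒m<1+n w<N)))
                                  (off N ≤-refl (λ N≡s → <-irrefl (sym N≡s) s<N)))
                       (+-identityʳ (f s))
... | inj₂ refl = cong (_+ f s) (Σ-zero s (λ w w<s → off w (m<n⇒m<1+n w<s) (λ w≡s → <-irrefl w≡s w<s)))

Σ-point : ∀ N s (h : ℕ → ℕ) → s < N → Σ< N (λ w → if w ≡ᵇ s then h w else 0) ≡ h s
Σ-point N s h s<N =
  trans (Σ-single N s _ s<N (λ w _ w≢s → cong (λ b → if b then h w else 0) (≡ᵇ-false w s w≢s)))
        (cong (λ b → if b then h s else 0) (≡ᵇ-refl s))

count : {A : Set} → (A → Bool) → List A → ℕ
count p xs = length (filterᵇ p xs)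

count-∷ : {A : Set} (p : A → Bool) (x : A) (xs : List A) →
  count p (x ∷ xs) ≡ (if p x then 1 else 0) + count p xs
count-∷ p x xs with p x
... | true  = refl
... | false = refl

count-++ : {A : Set} (p : A → Bool) (xs ys : List A) → count p (xs ++ ys) ≡ count p xs + count p ys
count-++ p []       ys = refl
count-++ p (x ∷ xs) ys rewrite count-∷ p x (xs ++ ys) | count-∷ p x xs | count-++ p xs ys =
  sym (+-assoc (if p x then 1 else 0) _ _)

count-map : {A B : Set} (p : B → Bool) (g : A → B) (xs : List A) → count p (map g xs) ≡ count (λ x → p (g x)) xs
count-map p g []       = refl
count-map p g (x ∷ xs) rewrite count-∷ p (g x) (map g xs) | count-∷ (λ x → p (g x)) x xs | count-map p g xs = refl

count-concatMap : {A B : Set} (p : B → Bool) (f : A → List B) (xs : List A) →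
  count p (concatMap f xs) ≡ sum (map (λ x → count p (f x)) xs)
count-concatMap p f []       = refl
count-concatMap p f (x ∷ xs) = trans (count-++ p (f x) (concatMap f xs)) (cong (count p (f x) +_) (count-concatMap p f xs))

count-guard : {A : Set} (b : Bool) (q : A → Bool) (xs : List A) → count (λ r → b ∧ q r) xs ≡ (if b then count q xs else 0)
count-guard true  q xs       = refl
count-guard false q []       = refl
count-guard false q (x ∷ xs) = count-guard false q xs

sum-upTo : ∀ (g : ℕ → ℕ) N → sum (map g (upTo N)) ≡ Σ< N g
sum-upTo g N = trans (cong sum (map-applyUpTo (λ x → x) g N)) (sum-applyUpTo g N)
  where
  sum-applyUpTo : ∀ (g : ℕ → ℕ) N → sum (applyUpTo g N) ≡ Σ< N g
  sum-applyUpTo g zero    = refl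
  sum-applyUpTo g (suc N) = trans (cong (g 0 +_) (sum-applyUpTo (λ x → g (suc x)) N)) (sym (Σ-shift N g))

module Walks (N : ℕ) (G : Str) (t : ℕ) where
  walksTo : ℕ → ℕ → ℕ
  walksTo ℓ v = count (λ r → walkTo G t (v ∷ r)) (seqs N ℓ)

  walksTo-zero : ∀ v → walksTo 0 v ≡ (if v ≡ᵇ t then 1 else 0)
  walksTo-zero v = trans (count-∷ (λ r → walkTo G t (v ∷ r)) [] []) (+-identityʳ _)

  -- a sequence of length ℓ+1 is a first vertex w followed by a sequence of length ℓ
  count-seqs : ∀ ℓ (p : List ℕ → Bool) → count p (seqs N (suc ℓ)) ≡ Σ< N (λ w → count (λ r → p (w ∷ r)) (seqs N ℓ))
  count-seqs ℓ p = begin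
    count p (seqs N (suc ℓ))                                   ≡⟨ count-concatMap p (λ v → map (v ∷_) (seqs N ℓ)) (upTo N) ⟩
    sum (map (λ w → count p (map (w ∷_) (seqs N ℓ))) (upTo N)) ≡⟨ cong sum (map-cong (λ w → count-map p (w ∷_) (seqs N ℓ)) (upTo N)) ⟩
    sum (map (λ w → count (λ r → p (w ∷ r)) (seqs N ℓ)) (upTo N)) ≡⟨ sum-upTo _ N ⟩
    Σ< N (λ w → count (λ r → p (w ∷ r)) (seqs N ℓ))            ∎
    where open ≡-Reasoning

  walksTo-suc : ∀ ℓ v → walksTo (suc ℓ) v ≡ Σ< N (λ w → if edge G v w then walksTo ℓ w else 0)
  walksTo-suc ℓ v = trans (count-seqs ℓ (λ r → walkTo G t (v ∷ r)))
    (Σ-cong N (λ w _ → count-guard (edge G v w) (λ r → walkTo G t (w ∷ r)) (seqs N ℓ)))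

  paths≡walksTo : ∀ s ℓ → s < N → pathsOfLen N s t G ℓ ≡ walksTo ℓ s
  paths≡walksTo s ℓ s<N = trans (count-seqs ℓ (isWalk G s t))
    (trans (Σ-cong N (λ w _ → count-guard (w ≡ᵇ s) (λ r → walkTo G t (w ∷ r)) (seqs N ℓ)))
           (Σ-point N s (walksTo ℓ) s<N))

≡ᵇ-sym : ∀ m n → (m ≡ᵇ n) ≡ (n ≡ᵇ m)
≡ᵇ-sym zero    zero    = refl
≡ᵇ-sym zero    (suc n) = refl
≡ᵇ-sym (suc m) zero    = refl
≡ᵇ-sym (suc m) (suc n) = ≡ᵇ-sym m n

indicator-*ˡ : ∀ (b : Bool) x → (if b then 1 else 0) * x ≡ (if b then x else 0)
indicator-*ˡ true  x = +-identityʳ x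
indicator-*ˡ false x = refl

mmul-idˡ : ∀ n (A : Mat) i j → i < n → mmul n idMat A i j ≡ A i j
mmul-idˡ n A i j i<n = trans
  (Σ-cong n (λ l _ → trans (cong (λ b → (if b then 1 else 0) * A l j) (≡ᵇ-sym i l)) (indicator-*ˡ (l ≡ᵇ i) (A l j))))
  (Σ-point n i (λ l → A l j) i<n)

mmul-idʳ : ∀ n (A : Mat) i j → j < n → mmul n A idMat i j ≡ A i j
mmul-idʳ n A i j j<n = trans
  (Σ-cong n (λ l _ → trans (*-comm (A i l) _) (indicator-*ˡ (l ≡ᵇ j) (A i l))))
  (Σ-point n j (λ l → A i l) j<n)

-- A^(r+1) = A · A^r (mpow multiplies on the right; associativity of the
-- sums moves the new factor to the left).
mpow-suc-left : ∀ n A r i j → i < n → j < n → mpow n A (suc r) i j ≡ Σ< n (λ l → A i l * mpow n A r l j)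
mpow-suc-left n A zero    i j i<n j<n = trans (mmul-idˡ n A i j i<n) (sym (mmul-idʳ n A i j j<n))
mpow-suc-left n A (suc r) i j i<n j<n = begin
  Σ< n (λ l → mpow n A (suc r) i l * A l j)               ≡⟨ Σ-cong n (λ l l<n → cong (_* A l j) (mpow-suc-left n A r i l i<n l<n)) ⟩
  Σ< n (λ l → Σ< n (λ m → A i m * P m l) * A l j)         ≡⟨ Σ-cong n (λ l _ → sym (Σ-*ʳ n (A l j) (λ m → A i m * P m l))) ⟩
  Σ< n (λ l → Σ< n (λ m → A i m * P m l * A l j))         ≡⟨ Σ-cong n (λ l _ → Σ-cong n (λ m _ → *-assoc (A i m) (P m l) (A l j))) ⟩
  Σ< n (λ l → Σ< n (λ m → A i m * (P m l * A l j)))       ≡⟨ Σ-swap n n (λ l m → A i m * (P m l * A l j)) ⟩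
  Σ< n (λ m → Σ< n (λ l → A i m * (P m l * A l j)))       ≡⟨ Σ-cong n (λ m _ → Σ-*ˡ n (A i m) (λ l → P m l * A l j)) ⟩
  Σ< n (λ m → A i m * mpow n A (suc r) m j)               ∎
  where
  open ≡-Reasoning
  P : Mat
  P = mpow n A r

n<2^n : ∀ n → n < 2 ^ n
n<2^n zero    = s≤s z≤n
n<2^n (suc n) = begin-strict
  suc n              <⟨ s≤s (n<2^n n) ⟩
  suc (2 ^ n)        ≡⟨ +-comm 1 (2 ^ n) ⟩
  2 ^ n + 1          ≤⟨ +-monoʳ-≤ (2 ^ n) (m^n>0 2 n) ⟩
  2 ^ n + 2 ^ n      ≡⟨ cong (2 ^ n +_) (sym (+-identityʳ (2 ^ n))) ⟩
  2 ^ suc n          ∎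
  where open ≤-Reasoning

-- Entries of A^r are at most (nW+1)^r ≤ 2^(nWr) when those of A are ≤ W;
-- this gives the polynomial length bound on the output.
mpow-bound : ∀ n W (A : Mat) → (∀ i j → A i j ≤ W) → ∀ r i j → mpow n A r i j ≤ 2 ^ (n * W * r)
mpow-bound n W A A≤W r i j = ≤-trans (poly r i j)
  (≤-trans (^-monoˡ-≤ r (subst (_≤ 2 ^ (n * W)) (+-comm 1 (n * W)) (n<2^n (n * W))))
           (≤-reflexive (^-*-assoc 2 (n * W) r)))
  where
  poly : ∀ r i j → mpow n A r i j ≤ (n * W + 1) ^ r
  poly zero i j with i ≡ᵇ j
  ... | true  = ≤-refl
  ... | false = z≤n
  poly (suc r) i j = begin
    Σ< n (λ l → mpow n A r i l * A l j)  ≤⟨ Σ-bound n (B * W) _ (λ l _ → *-mono-≤ (poly r i l) (A≤W l j)) ⟩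
    n * (B * W)                          ≡⟨ cong (n *_) (*-comm B W) ⟩
    n * (W * B)                          ≡⟨ sym (*-assoc n W B) ⟩
    n * W * B                            ≤⟨ *-monoˡ-≤ B (m≤m+n (n * W) 1) ⟩
    (n * W + 1) * B                      ∎
    where
    open ≤-Reasoning
    B : ℕ
    B = (n * W + 1) ^ r

bit≤exp : ∀ Z e b → Z ≤ 2 ^ e → bit Z b ≡ true → b ≤ e
bit≤exp Z e b Z≤2^e p with b ≤? e
... | yes b≤e = b≤e
... | no  b≰e = ⊥-elim (<⇒≱ (^-monoʳ-< 2 (s≤s (s≤s z≤n)) (≰⇒> b≰e)) (≤-trans (pow≤bit b Z p) Z≤2^e))

bit<self : ∀ Z b → bit Z b ≡ true → b < Z
bit<self Z b p = <-≤-trans (n<2^n b) (pow≤bit b Z p)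

triangle : ℕ → ℕ
triangle s = s * (s + 1)

-- triangle (s+1) = triangle s + 2s + 2, stated unfolded for the ring solver
triangle-suc : ∀ s → suc s * (suc s + 1) ≡ suc (suc (s * (s + 1) + 2 * s))
triangle-suc = solve-∀

pair<diagonal : ∀ x y s' y' → x + y < s' → ⟨ x , y ⟩ < triangle s' + 2 * y'
pair<diagonal x y s' y' lt = begin-strict
  triangle s + 2 * y         ≤⟨ +-monoʳ-≤ (triangle s) (*-monoʳ-≤ 2 (m≤n+m y x)) ⟩
  triangle s + 2 * s         <⟨ ≤-trans (n≤1+n _) (≤-reflexive (sym (triangle-suc s))) ⟩
  triangle (suc s)           ≤⟨ *-mono-≤ lt (+-monoˡ-≤ 1 lt) ⟩
  triangle s'                ≤⟨ m≤m+n (triangle s') (2 * y') ⟩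
  triangle s' + 2 * y'       ∎
  where
  open ≤-Reasoning
  s : ℕ
  s = x + y

pair-injective : ∀ x y x' y' → ⟨ x , y ⟩ ≡ ⟨ x' , y' ⟩ → x ≡ x' × y ≡ y'
pair-injective x y x' y' eq with <-cmp (x + y) (x' + y')
... | tri< lt _ _ = ⊥-elim (<-irrefl eq (pair<diagonal x y (x' + y') y' lt))
... | tri> _ _ gt = ⊥-elim (<-irrefl (sym eq) (pair<diagonal x' y' (x + y) y gt))
... | tri≈ _ s≡s' _ = x≡x' , y≡y'
  where
  y≡y' : y ≡ y'
  y≡y' = *-cancelˡ-≡ y y' 2 (+-cancelˡ-≡ (triangle (x + y)) (2 * y) (2 * y')
           (trans eq (cong (λ w → triangle w + 2 * y') (sym s≡s'))))
  x≡x' : x ≡ x'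
  x≡x' = +-cancelʳ-≡ y x x' (trans s≡s' (cong (x' +_) (sym y≡y')))

pair-≥ʳ : ∀ x y → y ≤ ⟨ x , y ⟩
pair-≥ʳ x y = ≤-trans (m≤n*m y 2) (m≤n+m (2 * y) (triangle (x + y)))

pair-≥ˡ : ∀ x y → x ≤ ⟨ x , y ⟩
pair-≥ˡ x y = begin
  x                        ≤⟨ m≤m+n x y ⟩
  x + y                    ≤⟨ m≤m*n (x + y) (suc (x + y)) ⟩
  (x + y) * suc (x + y)    ≡⟨ cong ((x + y) *_) (+-comm 1 (x + y)) ⟩
  triangle (x + y)         ≤⟨ m≤m+n (triangle (x + y)) (2 * y) ⟩
  ⟨ x , y ⟩                ∎
  where open ≤-Reasoning

pair-mono : ∀ {x y x' y'} → x ≤ x' → y ≤ y' → ⟨ x , y ⟩ ≤ ⟨ x' , y' ⟩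
pair-mono {x} {y} {x'} {y'} x≤x' y≤y' = +-mono-≤ (*-mono-≤ s≤s' (+-monoˡ-≤ 1 s≤s')) (*-monoʳ-≤ 2 y≤y')
  where
  s≤s' : x + y ≤ x' + y'
  s≤s' = +-mono-≤ x≤x' y≤y'

code< : ∀ C x q a → x < a → q < C → x * C + q < a * C
code< C x q a x<a q<C = begin-strict
  x * C + q   <⟨ +-monoʳ-< (x * C) q<C ⟩
  x * C + C   ≡⟨ +-comm (x * C) C ⟩
  suc x * C   ≤⟨ *-monoˡ-≤ C x<a ⟩
  a * C       ∎
  where open ≤-Reasoning

code-injective : ∀ C x q x' q' → q < C → q' < C → x * C + q ≡ x' * C + q' → x ≡ x' × q ≡ q'
code-injective C x q x' q' q<C q'<C eq with <-cmp x x'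
... | tri< lt _ _ = ⊥-elim (<-irrefl eq (<-≤-trans (code< C x q x' lt q<C) (m≤m+n (x' * C) q')))
... | tri> _ _ gt = ⊥-elim (<-irrefl (sym eq) (<-≤-trans (code< C x' q' x gt q'<C) (m≤m+n (x * C) q)))
... | tri≈ _ refl _ = refl , +-cancelˡ-≡ (x * C) q q' eq

least≤ : ∀ m P → least m P ≤ m
least≤ zero    P = z≤n
least≤ (suc m) P with P 0
... | true  = z≤n
... | false = s≤s (least≤ m (λ y → P (suc y)))

least≤witness : ∀ m P y → y < m → P y ≡ true → least m P ≤ y
least≤witness (suc m) P zero    y<m Py rewrite Py = z≤n
least≤witness (suc m) P (suc y) y<m Py with P 0
... | true  = z≤n
... | false = s≤s (least≤witness m (λ y → P (suc y)) y (s≤s⁻¹ y<m) Py)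

least>  : ∀ m P c → c < m → (∀ y → y ≤ c → P y ≡ false) → c < least m P
least> (suc m) P zero    c<m none rewrite none 0 z≤n = s≤s z≤n
least> (suc m) P (suc c) c<m none rewrite none 0 z≤n =
  s≤s (least> m (λ y → P (suc y)) c (s≤s⁻¹ c<m) (λ y y≤c → none (suc y) (s≤s y≤c)))

proj-above : ∀ Z j c → c < proj Z j ⇔ ((∀ y → y ≤ c → bit Z ⟨ j , y ⟩ ≡ true → ⊥) × c < ∣ Z ∣ₛ)
proj-above Z j c = mk⇔ into back
  where
  P : ℕ → Bool
  P y = bit Z ⟨ j , y ⟩
  into : c < proj Z j → (∀ y → y ≤ c → P y ≡ true → ⊥) × c < ∣ Z ∣ₛ
  into c<proj = none , <-≤-trans c<proj (least≤ _ P)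
    where
    none : ∀ y → y ≤ c → P y ≡ true → ⊥
    none y y≤c Py = <-irrefl refl (<-≤-trans c<proj (≤-trans (least≤witness _ P y y<∣Z∣ Py) y≤c))
      where
      y<∣Z∣ : y < ∣ Z ∣ₛ
      y<∣Z∣ = ≤-<-trans (pair-≥ʳ j y) (bit<len ⟨ j , y ⟩ Z Py)
  back : (∀ y → y ≤ c → P y ≡ true → ⊥) × c < ∣ Z ∣ₛ → c < proj Z j
  back (none , c<∣Z∣) = least> _ P c c<∣Z∣ (λ y y≤c → false-of (none y y≤c))
    where
    false-of : ∀ {b} → (b ≡ true → ⊥) → b ≡ false
    false-of {true}  ¬b = ⊥-elim (¬b refl)
    false-of {false} ¬b = refl

bit-row : ∀ X i b → bit (row X i) b ≡ true ⇔ (b < ∣ X ∣ₛ × bit X ⟨ i , b ⟩ ≡ true)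
bit-row X i b = bit-fromPred ∣ X ∣ₛ (λ b → bit X ⟨ i , b ⟩) b

entry≤len : ∀ i j X → entry i j X ≤ ∣ X ∣ₛ
entry≤len i j X = ≤-trans (least≤ _ _) (len-fromPred ∣ X ∣ₛ (λ b → bit X ⟨ i , b ⟩))

pairT : ∀ {L nv sv} → NTm L nv sv → NTm L nv sv → NTm L nv sv
pairT a b = ((a ⊕ b) ⊗ ((a ⊕ b) ⊕ one)) ⊕ ((one ⊕ one) ⊗ b)

lenT : ∀ {L nv} → NTm L nv 1
lenT = len (svar (# 0))

blockT : ∀ {L nv} → NTm L nv 1 → NTm L nv 1
blockT n = one ⊕ (n ⊗ lenT)

mainT : ∀ {L nv} → NTm L nv 1 → NTm L nv 1 → NTm L nv 1 → NTm L nv 1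
mainT n r i = (((r ⊗ n) ⊕ i) ⊗ blockT n) ⊕ zer

gadgetT : ∀ {L nv} → NTm L nv 1 → NTm L nv 1 → NTm L nv 1 → NTm L nv 1 → NTm L nv 1 → NTm L nv 1
gadgetT n r i j c = ((((one ⊕ r) ⊗ n) ⊕ i) ⊗ blockT n) ⊕ (one ⊕ ((j ⊗ lenT) ⊕ c))

sizeT : ∀ {L nv} → NTm L nv 1 → NTm L nv 1 → NTm L nv 1
sizeT n k = ((one ⊕ k) ⊗ n) ⊗ blockT n

-- "c < A[i,j]" for the matrix A encoded by X, with c, j, i the variables
-- 0, 1, 2.  By 'proj-above' this says: X^[i] has no ⟨j,y⟩ with y ≤ c, and
-- X^[i] has an element b ≥ c.
entryAboveφ : ∀ {L nv} → Fm L (3 + nv) 1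
entryAboveφ =
  (∀≤ (nvar (# 0)) (¬ᶠ (((one ⊕ pairT (nvar (# 2)) (nvar (# 0))) ≤ᶠ lenT) ∧ᶠ
                        mem (pairT (nvar (# 3)) (pairT (nvar (# 2)) (nvar (# 0)))) (svar (# 0))))) ∧ᶠ
  (∃≤ lenT (((one ⊕ nvar (# 0)) ≤ᶠ lenT) ∧ᶠ
            ((nvar (# 1) ≤ᶠ nvar (# 0)) ∧ᶠ mem (pairT (nvar (# 3)) (nvar (# 0))) (svar (# 0)))))

entryAboveφ-correct : ∀ {L nv} X i j c (ρ : Vec ℕ nv) →
  ⟦ entryAboveφ {L} ⟧ (c ∷ j ∷ i ∷ ρ) (X ∷ []) ⇔ c < entry i j X
entryAboveφ-correct {L} {nv} X i j c ρ = mk⇔ into back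
  where
  into : ⟦ entryAboveφ {L} {nv} ⟧ (c ∷ j ∷ i ∷ ρ) (X ∷ []) → c < entry i j X
  into (none , (b , _ , b<W , c≤b , Xb)) = from (proj-above (row X i) j c)
    ( (λ y y≤c p → none y y≤c (to (bit-row X i _) p))
    , from (len-above (row X i) c) (b , c≤b , from (bit-row X i b) (b<W , Xb)))
  back : c < entry i j X → ⟦ entryAboveφ {L} {nv} ⟧ (c ∷ j ∷ i ∷ ρ) (X ∷ [])
  back c<entry with to (proj-above (row X i) j c) c<entry
  ... | (none , c<len) with to (len-above (row X i) c) c<len
  ... | (b , c≤b , Rb) with to (bit-row X i b) Rb
  ... | (b<W , Xb) = (λ y y≤c p → none y y≤c (from (bit-row X i _) p)) , (b , <⇒≤ b<W , b<W , c≤b , Xb)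

-- The edges u → v of the layered graph; environment c j i r v u z n k:
-- r < k, i < n, j < n, c < |X| and either
--   u = main(r+1,i), v = gadget(r,i,j,c) and c < A[i,j],  or
--   u = gadget(r,i,j,c), v = main(r,j).
edgeCaseφ : ∀ {L} → Fm L 9 1
edgeCaseφ =
  ((one ⊕ r) ≤ᶠ k) ∧ᶠ (((one ⊕ i) ≤ᶠ n) ∧ᶠ (((one ⊕ j) ≤ᶠ n) ∧ᶠ (((one ⊕ c) ≤ᶠ lenT) ∧ᶠ
    (((u =ᶠ mainT n (one ⊕ r) i) ∧ᶠ ((v =ᶠ gadgetT n r i j c) ∧ᶠ entryAboveφ)) ∨ᶠ
     ((u =ᶠ gadgetT n r i j c) ∧ᶠ (v =ᶠ mainT n r j))))))
  where
  c j i r v u n k : ∀ {L} → NTm L 9 1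
  c = nvar (# 0)
  j = nvar (# 1)
  i = nvar (# 2)
  r = nvar (# 3)
  v = nvar (# 4)
  u = nvar (# 5)
  n = nvar (# 7)
  k = nvar (# 8)

-- environment v u z n k
edgeφ : ∀ {L} → Fm L 5 1
edgeφ = ∃≤ (nvar (# 4)) (∃≤ (nvar (# 4)) (∃≤ (nvar (# 5)) (∃≤ lenT edgeCaseφ)))

-- z codes an edge: z = ⟨u,v⟩ with u → v; environment z n k
edgeCodeφ : ∀ {L} → Fm L 3 1
edgeCodeφ = ∃≤ (nvar (# 0)) (∃≤ (nvar (# 1)) ((nvar (# 2) =ᶠ pairT (nvar (# 1)) (nvar (# 0))) ∧ᶠ edgeφ))

graphBoundT : ∀ {L nv} → NTm L nv 1 → NTm L nv 1 → NTm L nv 1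
graphBoundT n k = one ⊕ pairT (sizeT n k) (sizeT n k)

graphφ : Fm #STCON-Lang 3 1
graphφ = ((one ⊕ nvar (# 0)) ≤ᶠ graphBoundT (nvar (# 1)) (nvar (# 2))) ∧ᶠ edgeCodeφ

-- The auxiliary string function of the reduction: G(n,k,X) is the
-- adjacency matrix of the layered graph.
GraphF : SFun
GraphF = formulaFn 2 1 (graphBoundT (nvar (# 0)) (nvar (# 1))) graphφ

GraphF-definable : Σ0B-Definable #STCON-Lang GraphF
GraphF-definable = formulaFn-definable (graphBoundT (nvar (# 0)) (nvar (# 1))) graphφ
   (λ { (n ∷ k ∷ []) (X ∷ []) z (z<bound , _) → z<bound })

-- Vertices are numbered in blocks
-- of size C = 1 + n·W, W = |X| (which bounds every entry of A): block
-- r·n + i holds main(r,i) at offset 0 (r ≤ k) and, for r ≥ 1, the gadget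
-- vertices gadget(r-1,i,j,c) at offsets 1 + j·W + c.  A path main(r+1,i) →
-- gadget(r,i,j,c) → main(r,j) exists for each c < A[i,j], so there are
-- exactly A[i,j] two-step paths from main(r+1,i) to main(r,j).
module Layered (n k X : ℕ) where
  W C N : ℕ
  W = ∣ X ∣ₛ
  C = 1 + n * W
  N = ((1 + k) * n) * C

  A : Mat
  A = matOf X

  main : ℕ → ℕ → ℕ
  main r i = (r * n + i) * C + 0

  gadget : ℕ → ℕ → ℕ → ℕ → ℕ
  gadget r i j c = ((1 + r) * n + i) * C + (1 + (j * W + c))

  Edge : ℕ → ℕ → Set
  Edge u v = Σ ℕ λ r → Σ ℕ λ i → Σ ℕ λ j → Σ ℕ λ c → (r < k × i < n × j < n × c < W) ×
    ((u ≡ main (1 + r) i × v ≡ gadget r i j c × c < A i j) ⊎ (u ≡ gadget r i j c × v ≡ main r j))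

  edgeφ-correct : ∀ u v z → ⟦ edgeφ {#STCON-Lang} ⟧ (v ∷ u ∷ z ∷ n ∷ k ∷ []) (X ∷ []) ⇔ Edge u v
  edgeφ-correct u v z = mk⇔ into back
    where
    into : ⟦ edgeφ {#STCON-Lang} ⟧ (v ∷ u ∷ z ∷ n ∷ k ∷ []) (X ∷ []) → Edge u v
    into (r , _ , i , _ , j , _ , c , _ , r<k , i<n , j<n , c<W , (true , u≡ , v≡ , above)) =
      r , i , j , c , (r<k , i<n , j<n , c<W) , inj₁ (u≡ , v≡ , to (entryAboveφ-correct {#STCON-Lang} X i j c (r ∷ v ∷ u ∷ z ∷ n ∷ k ∷ [])) above)
    into (r , _ , i , _ , j , _ , c , _ , r<k , i<n , j<n , c<W , (false , u≡ , v≡)) =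
      r , i , j , c , (r<k , i<n , j<n , c<W) , inj₂ (u≡ , v≡)
    back : Edge u v → ⟦ edgeφ {#STCON-Lang} ⟧ (v ∷ u ∷ z ∷ n ∷ k ∷ []) (X ∷ [])
    back (r , i , j , c , (r<k , i<n , j<n , c<W) , inj₁ (u≡ , v≡ , c<A)) =
      r , <⇒≤ r<k , i , <⇒≤ i<n , j , <⇒≤ j<n , c , <⇒≤ c<W , r<k , i<n , j<n , c<W ,
      (true , u≡ , v≡ , from (entryAboveφ-correct {#STCON-Lang} X i j c (r ∷ v ∷ u ∷ z ∷ n ∷ k ∷ [])) c<A)
    back (r , i , j , c , (r<k , i<n , j<n , c<W) , inj₂ (u≡ , v≡)) =
      r , <⇒≤ r<k , i , <⇒≤ i<n , j , <⇒≤ j<n , c , <⇒≤ c<W , r<k , i<n , j<n , c<W , (false , u≡ , v≡)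

  G : Str
  G = SFun.fn GraphF (n ∷ k ∷ []) (X ∷ [])

  graph-bit : ∀ u v → u < N → v < N → bit G ⟨ u , v ⟩ ≡ true ⇔ Edge u v
  graph-bit u v u<N v<N = mk⇔ into back
    where
    z : ℕ
    z = ⟨ u , v ⟩
    bits : bit G z ≡ true ⇔ (z < suc ⟨ N , N ⟩ × ⟦ graphφ ⟧ (z ∷ n ∷ k ∷ []) (X ∷ []))
    bits = bit-formulaString (graphBoundT (nvar (# 0)) (nvar (# 1))) graphφ (n ∷ k ∷ []) (X ∷ []) z
    into : bit G z ≡ true → Edge u v
    into p with proj₂ (proj₂ (to bits p))
    ... | (u' , _ , v' , _ , z≡ , e) =
      let (u≡ , v≡) = pair-injective u v u' v' z≡ in
      subst₂ Edge (sym u≡) (sym v≡) (to (edgeφ-correct u' v' z) e)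
    z<bound : z < suc ⟨ N , N ⟩
    z<bound = s≤s (pair-mono (<⇒≤ u<N) (<⇒≤ v<N))
    back : Edge u v → bit G z ≡ true
    back e = from bits (z<bound , z<bound , (u , pair-≥ˡ u v , v , pair-≥ʳ u v , refl , from (edgeφ-correct u v z) e))

  0<C : 0 < C
  0<C = s≤s z≤n

  digit<C : ∀ j c → j < n → c < W → 1 + (j * W + c) < C
  digit<C j c j<n c<W = s≤s (code< W j c n j<n c<W)

  main≢gadget : ∀ x x' j c → j < n → c < W → x * C + 0 ≡ x' * C + (1 + (j * W + c)) → ⊥
  main≢gadget x x' j c j<n c<W eq with proj₂ (code-injective C x 0 x' _ 0<C (digit<C j c j<n c<W) eq)
  ... | ()

  block<N : ∀ r i → r < 1 + k → i < n → r * n + i < (1 + k) * n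
  block<N r i r≤k i<n = code< n r i (1 + k) r≤k i<n

  block-injective : ∀ r i r' i' → i < n → i' < n → r * n + i ≡ r' * n + i' → r ≡ r' × i ≡ i'
  block-injective r i r' i' = code-injective n r i r' i'

  main<N : ∀ r i → r ≤ k → i < n → main r i < N
  main<N r i r≤k i<n = code< C (r * n + i) 0 ((1 + k) * n) (block<N r i (s≤s r≤k) i<n) 0<C

  gadget<N : ∀ r i j c → r < k → i < n → j < n → c < W → gadget r i j c < N
  gadget<N r i j c r<k i<n j<n c<W =
    code< C ((1 + r) * n + i) _ ((1 + k) * n) (block<N (1 + r) i (s≤s r<k) i<n) (digit<C j c j<n c<W)

  gadget-injective : ∀ r i j c r' i' j' c' → i < n → i' < n → j < n → j' < n → c < W → c' < W →
    gadget r i j c ≡ gadget r' i' j' c' → r ≡ r' × i ≡ i' × j ≡ j' × c ≡ c'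
  gadget-injective r i j c r' i' j' c' i<n i'<n j<n j'<n c<W c'<W eq
    with code-injective C ((1 + r) * n + i) _ ((1 + r') * n + i') _ (digit<C j c j<n c<W) (digit<C j' c' j'<n c'<W) eq
  ... | (block≡ , digit≡) with block-injective (1 + r) i (1 + r') i' i<n i'<n block≡
                              | code-injective W j c j' c' c<W c'<W (suc-injective digit≡)
  ... | (refl , refl) | (refl , refl) = refl , refl , refl , refl

  -- Every edge joins a main vertex and a gadget vertex, so there are no loops.
  Edge-irreflexive : ∀ u v → Edge u v → u ≡ v → ⊥
  Edge-irreflexive u v (r , i , j , c , (_ , _ , j<n , c<W) , inj₁ (refl , refl , _)) eq =
    main≢gadget ((1 + r) * n + i) ((1 + r) * n + i) j c j<n c<W eq
  Edge-irreflexive u v (r , i , j , c , (_ , _ , j<n , c<W) , inj₂ (refl , refl)) eq =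
    main≢gadget (r * n + j) ((1 + r) * n + i) j c j<n c<W (sym eq)

  edge-correct : ∀ u v → u < N → v < N → edge G u v ≡ true ⇔ Edge u v
  edge-correct u v u<N v<N = mk⇔
    (λ p → to (graph-bit u v u<N v<N) (proj₂ (∧-true _ _ p)))
    (λ e → ∧-intro (cong not (≡ᵇ-false u v (Edge-irreflexive u v e))) (from (graph-bit u v u<N v<N) e))

  no-edge : ∀ u v → u < N → v < N → (Edge u v → ⊥) → edge G u v ≡ false
  no-edge u v u<N v<N ¬e with bool-cases (edge G u v)
  ... | inj₁ p = ⊥-elim (¬e (to (edge-correct u v u<N v<N) p))
  ... | inj₂ p = p

  Edge-from-gadget : ∀ r i j c w → r < k → i < n → j < n → c < W → Edge (gadget r i j c) w ⇔ w ≡ main r j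
  Edge-from-gadget r i j c w r<k i<n j<n c<W = mk⇔ into (λ w≡ → r , i , j , c , (r<k , i<n , j<n , c<W) , inj₂ (refl , w≡))
    where
    into : Edge (gadget r i j c) w → w ≡ main r j
    into (r' , i' , j' , c' , (_ , i'<n , j'<n , c'<W) , inj₁ (u≡ , _ , _)) =
      ⊥-elim (main≢gadget ((1 + r') * n + i') ((1 + r) * n + i) j c j<n c<W (sym u≡))
    into (r' , i' , j' , c' , (_ , i'<n , j'<n , c'<W) , inj₂ (u≡ , w≡))
      with gadget-injective r i j c r' i' j' c' i<n i'<n j<n j'<n c<W c'<W u≡
    ... | (refl , refl , refl , refl) = w≡

  Edge-from-main0 : ∀ i w → i < n → Edge (main 0 i) w → ⊥
  Edge-from-main0 i w i<n (r' , i' , _ , _ , (_ , i'<n , _) , inj₁ (u≡ , _ , _))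
    with block-injective 0 i (1 + r') i' i<n i'<n (proj₁ (code-injective C (0 * n + i) 0 ((1 + r') * n + i') 0 0<C 0<C u≡))
  ... | ()
  Edge-from-main0 i w i<n (r' , i' , j' , c' , (_ , _ , j'<n , c'<W) , inj₂ (u≡ , _)) =
    main≢gadget (0 * n + i) ((1 + r') * n + i') j' c' j'<n c'<W u≡

  Edge-main-main : ∀ r i x → Edge (main r i) (x * C + 0) → ⊥
  Edge-main-main r i x (r' , i' , j' , c' , (_ , _ , j'<n , c'<W) , inj₁ (_ , v≡ , _)) =
    main≢gadget x ((1 + r') * n + i') j' c' j'<n c'<W v≡
  Edge-main-main r i x (r' , i' , j' , c' , (_ , _ , j'<n , c'<W) , inj₂ (u≡ , _)) =
    main≢gadget (r * n + i) ((1 + r') * n + i') j' c' j'<n c'<W u≡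

  Edge-main-gadget : ∀ r i x j c → r < k → i < n → j < n → c < W →
    Edge (main (1 + r) i) (x * C + (1 + (j * W + c))) ⇔ (x ≡ (1 + r) * n + i × c < A i j)
  Edge-main-gadget r i x j c r<k i<n j<n c<W = mk⇔ into back
    where
    into : Edge (main (1 + r) i) (x * C + (1 + (j * W + c))) → x ≡ (1 + r) * n + i × c < A i j
    into (r' , i' , j' , c' , (_ , i'<n , j'<n , c'<W) , inj₁ (u≡ , v≡ , c'<A))
      with block-injective (1 + r) i (1 + r') i' i<n i'<n (proj₁ (code-injective C ((1 + r) * n + i) 0 ((1 + r') * n + i') 0 0<C 0<C u≡))
    ... | (refl , refl) with code-injective C x _ ((1 + r') * n + i') _ (digit<C j c j<n c<W) (digit<C j' c' j'<n c'<W) v≡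
    ... | (refl , digit≡) with code-injective W j c j' c' c<W c'<W (suc-injective digit≡)
    ... | (refl , refl) = refl , c'<A
    into (r' , i' , j' , c' , (_ , _ , j'<n , c'<W) , inj₂ (u≡ , _)) =
      ⊥-elim (main≢gadget ((1 + r) * n + i) ((1 + r') * n + i') j' c' j'<n c'<W u≡)
    back : x ≡ (1 + r) * n + i × c < A i j → Edge (main (1 + r) i) (x * C + (1 + (j * W + c)))
    back (refl , c<A) = r , i , j , c , (r<k , i<n , j<n , c<W) , inj₁ (refl , refl , c<A)

module Successors (n k X : ℕ) where
  open Layered n k X

  out : (ℕ → ℕ) → ℕ → ℕ
  out g u = Σ< N (λ w → if edge G u w then g w else 0)

  out-gadget : ∀ g r i j c → r < k → i < n → j < n → c < W → out g (gadget r i j c) ≡ g (main r j)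
  out-gadget g r i j c r<k i<n j<n c<W =
    trans (Σ-single N (main r j) _ target<N elsewhere)
          (cong (λ b → if b then g (main r j) else 0) (from (edge-correct _ _ source<N target<N) (from (successor (main r j)) refl)))
    where
    source<N : gadget r i j c < N
    source<N = gadget<N r i j c r<k i<n j<n c<W
    target<N : main r j < N
    target<N = main<N r j (<⇒≤ r<k) j<n
    successor : ∀ w → Edge (gadget r i j c) w ⇔ w ≡ main r j
    successor w = Edge-from-gadget r i j c w r<k i<n j<n c<W
    elsewhere : ∀ w → w < N → (w ≡ main r j → ⊥) → (if edge G (gadget r i j c) w then g w else 0) ≡ 0
    elsewhere w w<N w≢ rewrite no-edge _ w source<N w<N (λ e → w≢ (to (successor w) e)) = refl

  out-main0 : ∀ g i → i < n → out g (main 0 i) ≡ 0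
  out-main0 g i i<n = Σ-zero N (λ w w<N → cong (λ b → if b then g w else 0)
    (no-edge _ w (main<N 0 i z≤n i<n) w<N (Edge-from-main0 i w i<n)))

  out-main : ∀ g r i → r < k → i < n →
    out g (main (1 + r) i) ≡ Σ< n (λ j → Σ< W (λ c → if c <ᵇ A i j then g (gadget r i j c) else 0))
  out-main g r i r<k i<n = begin
    Σ< N h                                        ≡⟨ Σ-blocks B C h ⟩
    Σ< B (λ x → Σ< C (λ q → h (x * C + q)))       ≡⟨ Σ-cong B in-block ⟩
    Σ< B gadgetSum                                ≡⟨ Σ-single B x₀ gadgetSum (block<N (1 + r) i (s≤s r<k) i<n) other-block ⟩
    gadgetSum x₀                                  ≡⟨ Σ-cong n (λ j j<n → Σ-cong W (λ c c<W → own-block j c j<n c<W)) ⟩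
    Σ< n (λ j → Σ< W (λ c → if c <ᵇ A i j then g (gadget r i j c) else 0)) ∎
    where
    open ≡-Reasoning
    u : ℕ
    u = main (1 + r) i
    u<N : u < N
    u<N = main<N (1 + r) i r<k i<n
    B x₀ : ℕ
    B = (1 + k) * n
    x₀ = (1 + r) * n + i
    h : ℕ → ℕ
    h w = if edge G u w then g w else 0
    gadgetSum : ℕ → ℕ
    gadgetSum x = Σ< n (λ j → Σ< W (λ c → h (x * C + (1 + (j * W + c)))))
    -- offset 0 of a block is a main vertex, never a successor of u
    in-block : ∀ x → x < B → Σ< C (λ q → h (x * C + q)) ≡ gadgetSum x
    in-block x x<B = trans (Σ-shift (n * W) (λ q → h (x * C + q)))
      (cong₂ _+_ (cong (λ b → if b then g (x * C + 0) else 0)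
                       (no-edge u _ u<N (code< C x 0 B x<B 0<C) (Edge-main-main (1 + r) i x)))
                 (Σ-blocks n W (λ q → h (x * C + suc q))))
    other-block : ∀ x → x < B → (x ≡ x₀ → ⊥) → gadgetSum x ≡ 0
    other-block x x<B x≢x₀ = Σ-zero n (λ j j<n → Σ-zero W (λ c c<W →
      cong (λ b → if b then g _ else 0)
        (no-edge u _ u<N (code< C x _ B x<B (digit<C j c j<n c<W))
          (λ e → x≢x₀ (proj₁ (to (Edge-main-gadget r i x j c r<k i<n j<n c<W) e))))))
    own-block : ∀ j c → j < n → c < W → h (x₀ * C + (1 + (j * W + c))) ≡ (if c <ᵇ A i j then g (gadget r i j c) else 0)
    own-block j c j<n c<W = cong (λ b → if b then g (gadget r i j c) else 0) edge≡threshold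
      where
      v<N : gadget r i j c < N
      v<N = gadget<N r i j c r<k i<n j<n c<W
      successor : Edge u (gadget r i j c) ⇔ (x₀ ≡ x₀ × c < A i j)
      successor = Edge-main-gadget r i x₀ j c r<k i<n j<n c<W
      edge≡threshold : edge G u (gadget r i j c) ≡ (c <ᵇ A i j)
      edge≡threshold with bool-cases (c <ᵇ A i j)
      ... | inj₁ c<A = trans (from (edge-correct u _ u<N v<N) (from successor (refl , <ᵇ⇒< c (A i j) (from T-≡ c<A))))
                             (sym c<A)
      ... | inj₂ c≮A = trans (no-edge u _ u<N v<N (λ e → true≢false (trans (sym (<ᵇ-true c (A i j) (proj₂ (to successor e)))) c≮A)))
                             (sym c≮A)

module PathCount (n k X j₀ : ℕ) (j₀<n : j₀ < n) where
  open Layered n k X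
  open Successors n k X
  open Walks N G (main 0 j₀)

  power : ℕ → ℕ → ℕ → ℕ
  power r i j = mpow n A r i j

  MainCount GadgetCount : ℕ → Set
  MainCount m = ∀ r i → r ≤ k → i < n →
    walksTo m (main r i) ≡ (if m ≡ᵇ r + r then power r i j₀ else 0)
  GadgetCount m = ∀ r i j c → r < k → i < n → j < n → c < W →
    walksTo m (gadget r i j c) ≡ (if m ≡ᵇ suc (r + r) then power r j j₀ else 0)

  -- only main(0,j₀) is the target itself
  main-count-0 : MainCount 0
  main-count-0 zero i r≤k i<n = trans (walksTo-zero (main 0 i)) (cong (λ b → if b then 1 else 0) same-target)
    where
    same-target : (main 0 i ≡ᵇ main 0 j₀) ≡ (i ≡ᵇ j₀)
    same-target with bool-cases (i ≡ᵇ j₀)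
    ... | inj₁ i≡ᵇj₀ rewrite i≡ᵇj₀ | ≡ᵇ-true i j₀ i≡ᵇj₀ = ≡ᵇ-refl (main 0 j₀)
    ... | inj₂ i≢ᵇj₀ rewrite i≢ᵇj₀ = ≡ᵇ-false _ _ (λ eq → true≢false (trans (sym (≡ᵇ-refl i))
            (trans (cong (i ≡ᵇ_) (proj₁ (code-injective C i 0 j₀ 0 0<C 0<C eq))) i≢ᵇj₀)))
  main-count-0 (suc r) i r≤k i<n = trans (walksTo-zero (main (suc r) i))
    (cong (λ b → if b then 1 else 0) (≡ᵇ-false _ _ other-layer))
    where
    other-layer : main (suc r) i ≡ main 0 j₀ → ⊥
    other-layer eq with block-injective (suc r) i 0 j₀ i<n j₀<n (proj₁ (code-injective C _ 0 _ 0 0<C 0<C eq))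
    ... | ()

  gadget-count-0 : GadgetCount 0
  gadget-count-0 r i j c r<k i<n j<n c<W = trans (walksTo-zero (gadget r i j c))
    (cong (λ b → if b then 1 else 0) (≡ᵇ-false _ _ (λ eq → main≢gadget (0 * n + j₀) ((1 + r) * n + i) j c j<n c<W (sym eq))))

  gadget-count-suc : ∀ m → MainCount m → GadgetCount (suc m)
  gadget-count-suc m IH r i j c r<k i<n j<n c<W = begin
    walksTo (suc m) (gadget r i j c)  ≡⟨ walksTo-suc m (gadget r i j c) ⟩
    out (walksTo m) (gadget r i j c)  ≡⟨ out-gadget (walksTo m) r i j c r<k i<n j<n c<W ⟩
    walksTo m (main r j)              ≡⟨ IH r j (<⇒≤ r<k) j<n ⟩
    (if m ≡ᵇ r + r then power r j j₀ else 0) ∎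
    where open ≡-Reasoning

  -- the c < A[i,j] gadgets each contribute the same count
  main-count-suc-layer : ∀ m r i → GadgetCount m → r < k → i < n →
    walksTo (suc m) (main (suc r) i) ≡ (if m ≡ᵇ suc (r + r) then power (suc r) i j₀ else 0)
  main-count-suc-layer m r i IH r<k i<n = begin
    walksTo (suc m) (main (suc r) i)                               ≡⟨ walksTo-suc m (main (suc r) i) ⟩
    out (walksTo m) (main (suc r) i)                               ≡⟨ out-main (walksTo m) r i r<k i<n ⟩
    Σ< n (λ j → Σ< W (λ c → if c <ᵇ A i j then walksTo m (gadget r i j c) else 0))
                                                                   ≡⟨ Σ-cong n per-column ⟩
    Σ< n (λ j → A i j * walksFrom j)                               ≡⟨ matrix-step ⟩
    (if m ≡ᵇ suc (r + r) then power (suc r) i j₀ else 0)           ∎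
    where
    open ≡-Reasoning
    walksFrom : ℕ → ℕ
    walksFrom j = if m ≡ᵇ suc (r + r) then power r j j₀ else 0
    per-column : ∀ j → j < n → Σ< W (λ c → if c <ᵇ A i j then walksTo m (gadget r i j c) else 0) ≡ A i j * walksFrom j
    per-column j j<n = trans (Σ-cong W (λ c c<W → cong (λ v → if c <ᵇ A i j then v else 0) (IH r i j c r<k i<n j<n c<W)))
                             (Σ-threshold W (A i j) (walksFrom j) (entry≤len i j X))
    matrix-step : Σ< n (λ j → A i j * walksFrom j) ≡ (if m ≡ᵇ suc (r + r) then power (suc r) i j₀ else 0)
    matrix-step with m ≡ᵇ suc (r + r)
    ... | true  = sym (mpow-suc-left n A r i j₀ i<n j₀<n)
    ... | false = Σ-zero n (λ j _ → *-zeroʳ (A i j))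

  main-count-suc : ∀ m → GadgetCount m → MainCount (suc m)
  main-count-suc m IH zero    i r≤k i<n = trans (walksTo-suc m (main 0 i)) (out-main0 (walksTo m) i i<n)
  main-count-suc m IH (suc r) i r<k i<n =
    trans (main-count-suc-layer m r i IH r<k i<n)
          (cong (λ x → if m ≡ᵇ x then power (suc r) i j₀ else 0) (sym (+-suc r r)))

  counts : ∀ m → MainCount m × GadgetCount m
  counts zero    = main-count-0 , gadget-count-0
  counts (suc m) = main-count-suc m (proj₂ (counts m)) , gadget-count-suc m (proj₁ (counts m))

  -- Paths of length ≤ 2k from main(k,i) to main(0,j₀) all have length 2k.
  #STCON-layered : ∀ i → i < n → #STCON N (main k i) (main 0 j₀) (k + k) G ≡ power k i j₀
  #STCON-layered i i<n = trans
    (Σ-cong (suc (k + k)) (λ ℓ _ → trans (paths≡walksTo (main k i) ℓ (main<N k i ≤-refl i<n))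
                                         (proj₁ (counts ℓ) k i ≤-refl i<n)))
    (Σ-point (suc (k + k)) (k + k) (λ _ → power k i j₀) ≤-refl)

-- Each of the three nested sums has
-- bit-disjoint summands by injectivity of the pairing function.
module Encoding (n : ℕ) (M : Mat) where
  Owns : ℕ → ℕ → ℕ → ℕ → Set
  Owns i j b z = bit (M i j) b ≡ true × ⟨ ⟨ i , j ⟩ , b ⟩ ≡ z

  entryCode : ℕ → ℕ → ℕ
  entryCode i j = Σ< (suc (M i j)) (λ b → if bit (M i j) b then 2 ^ ⟨ ⟨ i , j ⟩ , b ⟩ else 0)

  rowCode : ℕ → ℕ
  rowCode i = Σ< n (entryCode i)

  bit-entryCode : ∀ i j z → bit (entryCode i j) z ≡ true ⇔ (Σ ℕ λ b → b < suc (M i j) × Owns i j b z)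
  bit-entryCode i j = sum-bits (suc (M i j)) _ (λ b → Owns i j b)
    (λ b z → bit-if-pow (bit (M i j) b) ⟨ ⟨ i , j ⟩ , b ⟩ z)
    (λ { b b' z (_ , e) (_ , e') → proj₂ (pair-injective ⟨ i , j ⟩ b ⟨ i , j ⟩ b' (trans e (sym e'))) })

  bit-rowCode : ∀ i z → bit (rowCode i) z ≡ true ⇔ (Σ ℕ λ j → j < n × Σ ℕ λ b → b < suc (M i j) × Owns i j b z)
  bit-rowCode i = sum-bits n (entryCode i) _ (λ j → bit-entryCode i j)
    (λ { j j' z (b , _ , _ , e) (b' , _ , _ , e') →
         proj₂ (pair-injective i j i j' (proj₁ (pair-injective ⟨ i , j ⟩ b ⟨ i , j' ⟩ b' (trans e (sym e'))))) })

  EncodedBit : ℕ → Set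
  EncodedBit z = Σ ℕ λ i → i < n × Σ ℕ λ j → j < n × Σ ℕ λ b → b < suc (M i j) × Owns i j b z

  bit-encodeMat : ∀ z → bit (encodeMat n M) z ≡ true ⇔ EncodedBit z
  bit-encodeMat = sum-bits n rowCode _ bit-rowCode
    (λ { i i' z (j , _ , b , _ , _ , e) (j' , _ , b' , _ , _ , e') →
         proj₁ (pair-injective i j i' j' (proj₁ (pair-injective ⟨ i , j ⟩ b ⟨ i' , j' ⟩ b' (trans e (sym e'))))) })

-- The language L ∪ {G}, with #STCON the string function 0 and G the 1.
GraphLang : Lang
GraphLang = addS #STCON-Lang (GraphF ∷ [])

-- z ∈ PowNat(n,k,X) iff z = ⟨⟨i,j⟩,b⟩ with i, j < n and
-- b ∈ #STCON(N, main(k,i), main(0,j), 2k, G(n,k,X)); environment b j i z n k.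
powφ : Fm GraphLang 3 1
powφ = ∃≤ (nvar (# 0)) (∃≤ (nvar (# 1)) (∃≤ (nvar (# 2))
  (((one ⊕ i) ≤ᶠ n) ∧ᶠ (((one ⊕ j) ≤ᶠ n) ∧ᶠ ((z =ᶠ pairT (pairT i j) b) ∧ᶠ
     mem b (sapp (# 0) (sizeT n k ∷ mainT n k i ∷ mainT n zer j ∷ (k ⊕ k) ∷ [])
                       (sapp (# 1) (n ∷ k ∷ []) (svar (# 0) ∷ []) ∷ [])))))))
  where
  b j i z n k : NTm GraphLang 6 1
  b = nvar (# 0)
  j = nvar (# 1)
  i = nvar (# 2)
  z = nvar (# 3)
  n = nvar (# 4)
  k = nvar (# 5)

powBoundT : NTm L∅ 2 1
powBoundT = one ⊕ pairT (pairT (nvar (# 0)) (nvar (# 0))) ((nvar (# 0) ⊗ lenT) ⊗ nvar (# 1))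

module PowNatBits (n k X : ℕ) where
  open Layered n k X using (A; W; N; main; G)
  Aᵏ : Mat
  Aᵏ = mpow n A k
  open Encoding n Aᵏ

  entry-by-#STCON : ∀ i j → i < n → j < n → #STCON N (main k i) (main 0 j) (k + k) G ≡ Aᵏ i j
  entry-by-#STCON i j i<n j<n = PathCount.#STCON-layered n k X j j<n i i<n

  powφ-correct : ∀ z → bit (powNat n k X) z ≡ true ⇔ ⟦ powφ ⟧ (z ∷ n ∷ k ∷ []) (X ∷ [])
  powφ-correct z = mk⇔ (λ p → into (to (bit-encodeMat z) p)) back
    where
    into : ∀ {z} → EncodedBit z → ⟦ powφ ⟧ (z ∷ n ∷ k ∷ []) (X ∷ [])
    into (i , i<n , j , j<n , b , _ , Ab , refl) =
      i , ≤-trans (pair-≥ˡ i j) (pair-≥ˡ ⟨ i , j ⟩ b) , j , ≤-trans (pair-≥ʳ i j) (pair-≥ˡ ⟨ i , j ⟩ b) ,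
      b , pair-≥ʳ ⟨ i , j ⟩ b , i<n , j<n , refl , subst (λ v → bit v b ≡ true) (sym (entry-by-#STCON i j i<n j<n)) Ab
    back : ⟦ powφ ⟧ (z ∷ n ∷ k ∷ []) (X ∷ []) → bit (powNat n k X) z ≡ true
    back (i , _ , j , _ , b , _ , i<n , j<n , z≡ , b∈) =
      from (bit-encodeMat z) (i , i<n , j , j<n , b , m<n⇒m<1+n (bit<self (Aᵏ i j) b Ab) , Ab , sym z≡)
      where
      Ab : bit (Aᵏ i j) b ≡ true
      Ab = subst (λ v → bit v b ≡ true) (entry-by-#STCON i j i<n j<n) b∈

  -- entries of A are ≤ W, so those of A^k have at most n·W·k bits
  length-bound : ∣ powNat n k X ∣ₛ ≤ suc ⟨ ⟨ n , n ⟩ , n * W * k ⟩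
  length-bound = len-bound (powNat n k X) _ (λ z p → bounded (to (bit-encodeMat z) p))
    where
    bounded : ∀ {z} → EncodedBit z → z < suc ⟨ ⟨ n , n ⟩ , n * W * k ⟩
    bounded (i , i<n , j , j<n , b , _ , Ab , refl) =
      s≤s (pair-mono (pair-mono (<⇒≤ i<n) (<⇒≤ j<n))
        (bit≤exp (Aᵏ i j) (n * W * k) b (mpow-bound n W A (λ i j → entry≤len i j X) k i j) Ab))

PowNat-definable : Σ0B-Definable GraphLang PowNatF
PowNat-definable = powBoundT , powφ , λ { (n ∷ k ∷ []) (X ∷ []) →
  PowNatBits.length-bound n k X , λ z → to (PowNatBits.powφ-correct n k X z) , from (PowNatBits.powφ-correct n k X z) }

mainTheorem3 : AC0-Reducible PowNatF #STCON-Lang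
mainTheorem3 = GraphF ∷ [] , (GraphF-definable , tt) , PowNat-definable
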